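{- Let $\alpha=(1,1)$, $\beta=(3,2,2)$, $\gamma=(3,3,1,1,1)$. Then $C_{\alpha,\beta}^{\gamma}=0$, while $C_{2\alpha,2\beta}^{2\gamma}=C_{(2,2),(6,4,4)}^{(6,6,2,2,2)}=1$. Consequently, the statement "for all compositions $\alpha,\beta,\gamma$ and positive integers $N$, $C_{\alpha,\beta}^{\gamma}\neq 0$ if and only if $C_{N\alpha,N\beta}^{N\gamma}\neq0$" is false.
   Context: A composition is a finite sequence $\alpha=(\alpha_1,\dots,\alpha_m)$ of positive integers; for a positive integer $N$, $N\alpha=(N\alpha_1,\dots,N\alpha_m)$. $\mathrm{NSym}$ is the free associative (noncommutative) $\mathbb{Q}$-algebra generated by $H_1,H_2,\dots$, with $H_i$ of degree $i$; set $H_0=1$ and $H_m=0$ for $m<0$, and for an integer vector $(a_1,\dots,a_k)$ write $H_{(a_1,\dots,a_k)}=H_{a_1}\cdots H_{a_k}$. For a composition $\alpha=(\alpha_1,\dots,\alpha_k)$ the immaculate function is $\mathfrak{S}_{\alpha}=\sum_{\sigma\in S_k}(-1)^{\sigma}H_{(\alpha_1+\sigma_1-1,\alpha_2+\sigma_2-2,\dots,\alpha_k+\sigma_k-k)}$; the $\mathfrak{S}_\alpha$ with $\alpha$ ranging over compositions of $n$ form a basis of the degree-$n$ part of $\mathrm{NSym}$. The structure constants $C_{\alpha,\beta}^{\gamma}$ are defined by $\mathfrak{S}_{\alpha}\mathfrak{S}_{\beta}=\sum_{\gamma}C_{\alpha,\beta}^{\gamma}\mathfrak{S}_{\gamma}$,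 the sum over compositions $\gamma$. -}

module Defs where

open import Data.Nat as ℕ using (ℕ; zero; suc; _≤?_)
open import Data.Integer as ℤ using (ℤ; +_; -[1+_])
open import Data.Rational as ℚ using (ℚ; 0ℚ; 1ℚ; -_)
open import Data.List using (List; []; _∷_; map; concatMap; foldr; zipWith; length; upTo; _++_)
open import Data.List.Properties using (≡-dec)
open import Data.List.Relation.Unary.All using (All)
open import Data.Maybe using (Maybe; just; nothing)
open import Data.Product using (_×_; _,_; Σ; proj₁; proj₂)
open import Data.Bool using (Bool; true; false; if_then_else_)
open import Relation.Binary.PropositionalEquality using (_≡_)
open import Relation.Nullary using (does)

IsComposition : List ℕ → Set
IsComposition = All (λ a → 0 ℕ.< a)

_·c_ : ℕ → List ℕ → List ℕ
N ·c α = map (N ℕ.*_) α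

-- NSym = free associative ℚ-algebra on H₁, H₂, …
-- An element is represented by its coefficient function on the monomial
-- basis H_w = H_{w₁}⋯H_{wₖ} (w a word of positive integers, i.e. a
-- composition; the empty word is the unit 1).  All constructions below
-- are finitely supported and vanish on words with a zero entry.

NSym : Set
NSym = List ℕ → ℚ

_≈N_ : NSym → NSym → Set
f ≈N g = ∀ w → f w ≡ g w

infix 4 _≈N_

eqW : List ℕ → List ℕ → Bool
eqW u v = does (≡-dec ℕ._≟_ u v)

0N : NSym
0N _ = 0ℚ

_⊕_ : NSym → NSym → NSym
(f ⊕ g) w = f w ℚ.+ g w

infixl 6 _⊕_

_⊙_ : ℚ → NSym → NSym
(q ⊙ f) w = q ℚ.* f w

infixl 7 _⊙_

ΣN : List NSym → NSym
ΣN = foldr _⊕_ 0N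

splits : List ℕ → List (List ℕ × List ℕ)
splits []      = ([] , []) ∷ []
splits (a ∷ w) = ([] , a ∷ w) ∷ map (λ p → (a ∷ proj₁ p , proj₂ p)) (splits w)

_⊗_ : NSym → NSym → NSym
(f ⊗ g) w = foldr ℚ._+_ 0ℚ (map (λ p → f (proj₁ p) ℚ.* g (proj₂ p)) (splits w))

infixl 7 _⊗_

mono : List ℕ → NSym
mono w v = if eqW w v then 1ℚ else 0ℚ

-- For an integer vector a = (a₁,…,aₖ): H_a = H_{a₁}⋯H_{aₖ},
-- with H₀ = 1 and H_m = 0 for m < 0.
normVec : List ℤ → Maybe (List ℕ)
normVec []               = just []
normVec (-[1+ _ ] ∷ a)   = nothing
normVec (+ zero ∷ a)     = normVec a
normVec (+ suc n ∷ a) with normVec a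
... | nothing = nothing
... | just w  = just (suc n ∷ w)

Hvec : List ℤ → NSym
Hvec a with normVec a
... | nothing = 0N
... | just w  = mono w

-- Permutations of {1,…,k} in one-line notation, and their sign

insertAll : ℕ → List ℕ → List (List ℕ)
insertAll x []       = (x ∷ []) ∷ []
insertAll x (y ∷ ys) = (x ∷ y ∷ ys) ∷ map (y ∷_) (insertAll x ys)

perms : ℕ → List (List ℕ)
perms zero    = [] ∷ []
perms (suc k) = concatMap (insertAll (suc k)) (perms k)

inversions : List ℕ → ℕ
inversions []       = 0
inversions (x ∷ xs) = foldr (λ y n → if does (suc y ≤? x) then suc n else n) 0 xs ℕ.+ inversions xs

sign : List ℕ → ℚ
sign σ = if isEven (inversions σ) then 1ℚ else - 1ℚ
  where
    isEven : ℕ → Bool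
    isEven zero          = true
    isEven (suc zero)    = false
    isEven (suc (suc n)) = isEven n

immaculate : List ℕ → NSym
immaculate α = ΣN (map term (perms (length α)))
  where
    term : List ℕ → NSym
    term σ = sign σ ⊙ Hvec (zipWith (λ a p → (+ proj₁ a) ℤ.+ (+ proj₂ a) ℤ.- (+ p))
                                    (zipWith _,_ α σ) (upTo' (length α)))
      where
        upTo' : ℕ → List ℕ
        upTo' n = map suc (upTo n)

-- An immaculate expansion is a finite list of (composition, coefficient);
-- it denotes Σ c_γ 𝔖_γ.  The coefficient of γ is the sum of the
-- coefficients attached to γ (duplicates allowed, they add up).

Expansion : Set
Expansion = List (List ℕ × ℚ)

ValidExpansion : Expansion → Set
ValidExpansion = All (λ p → IsComposition (proj₁ p))

evalExp : Expansion → NSym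
evalExp e = ΣN (map (λ p → proj₂ p ⊙ immaculate (proj₁ p)) e)

coeffOf : List ℕ → Expansion → ℚ
coeffOf γ e = foldr ℚ._+_ 0ℚ (map (λ p → if eqW (proj₁ p) γ then proj₂ p else 0ℚ) e)

-- c is the structure constant C^γ_{α,β}: there is an expansion
-- 𝔖_α 𝔖_β = Σ_γ c_γ 𝔖_γ with coefficient c at γ, and every such expansion
-- has coefficient c at γ (so C^γ_{α,β} is well defined and equals c).
IsStructConst : List ℕ → List ℕ → List ℕ → ℚ → Set
IsStructConst α β γ c =
  Σ Expansion (λ e → ValidExpansion e × (immaculate α ⊗ immaculate β ≈N evalExp e) × coeffOf γ e ≡ c)
  × (∀ (e : Expansion) → ValidExpansion e → immaculate α ⊗ immaculate β ≈N evalExp e → coeffOf γ e ≡ c)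

module Submission where

-- The monomials H_w form a basis of NSym, so a finitely supported element is
-- a list of (word, coefficient) pairs read through `coeffOf`.

open import Defs
open import Data.Nat using (ℕ; _<_)
open import Data.List using (List; []; _∷_)
open import Data.Rational using (ℚ; 0ℚ; 1ℚ)
open import Data.Product using (_×_)
open import Relation.Binary.PropositionalEquality using (_≡_; _≢_)
open import Relation.Nullary using (¬_)
open import Function.Bundles using (_⇔_)

open import Data.Bool using (Bool; true; false; if_then_else_; _∧_)
open import Data.Empty using (⊥-elim)
open import Data.Integer as ℤ using (ℤ; +_)
import Data.Integer.Properties as ℤP
open import Data.List using (map; concatMap; filter; foldr; zipWith; length; upTo; _++_; _∷ʳ_)
import Data.List.Properties as LP
open import Data.List.Relation.Binary.Lex.Strict using (Lex-<; this; next; <-irreflexive; <-transitive; <-compare)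
import Data.List.Relation.Binary.Pointwise as Pointwise
open import Data.List.Relation.Unary.All as All using (All; []; _∷_)
import Data.List.Relation.Unary.All.Properties as AllP
open import Data.List.Relation.Unary.Any as Any using (Any; here; there)
open import Data.Maybe using (Maybe; just; nothing) renaming (map to mapMaybe)
open import Data.Nat as ℕ using (zero; suc; z≤n; s≤s)
import Data.Nat.Properties as ℕP
open import Data.Product using (_,_; proj₁; proj₂; ∃-syntax)
import Data.Rational as ℚ
import Data.Rational.Properties as ℚP
open import Data.Rational.Solver using (module +-*-Solver)
open import Data.Sum using (_⊎_; inj₁; inj₂)
open import Data.Unit using (tt)
open import Function using (_∘_)
open import Function.Bundles using (Equivalence)
open import Relation.Binary.Definitions using (DecidableEquality; tri<; tri≈; tri>)
open import Relation.Binary.PropositionalEquality using (refl; sym; trans; cong; cong₂; subst; isEquivalence; resp₂; module ≡-Reasoning)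
open import Relation.Nullary using (Dec; yes; no; does; ¬?)
open import Relation.Nullary.Decidable using (True; toWitness)

open +-*-Solver using (solve; _:=_; _:+_; _:*_; con)

-- 1. Words and monomials

_≟W_ : DecidableEquality (List ℕ)
_≟W_ = LP.≡-dec ℕ._≟_

mono-≡ : ∀ u w → u ≡ w → mono u w ≡ 1ℚ
mono-≡ u .u refl with u ≟W u
... | yes _   = refl
... | no u≢u  = ⊥-elim (u≢u refl)

mono-≢ : ∀ u w → u ≢ w → mono u w ≡ 0ℚ
mono-≢ u w u≢w with u ≟W w
... | yes u≡w = ⊥-elim (u≢w u≡w)
... | no _    = refl

mono-cons : ∀ a u w → mono (a ∷ u) (a ∷ w) ≡ mono u w
mono-cons a u w = byCases (u ≟W w)
  where
    byCases : Dec (u ≡ w) → mono (a ∷ u) (a ∷ w) ≡ mono u w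
    byCases (yes u≡w) = trans (mono-≡ (a ∷ u) (a ∷ w) (cong (a ∷_) u≡w)) (sym (mono-≡ u w u≡w))
    byCases (no u≢w)  = trans (mono-≢ (a ∷ u) (a ∷ w) (u≢w ∘ LP.∷-injectiveʳ)) (sym (mono-≢ u w u≢w))

mono-head : ∀ {a b} u w → a ≢ b → mono (a ∷ u) (b ∷ w) ≡ 0ℚ
mono-head {a} {b} u w a≢b = mono-≢ (a ∷ u) (b ∷ w) (a≢b ∘ LP.∷-injectiveˡ)

-- 2. Finitely supported elements of NSym as explicit lists

-- A list of (word, coefficient) pairs denotes Σ c·H_u; the coefficient of
-- H_w is extracted by `coeffOf` (repeated words add up).  The same lists,
-- read through `evalExp` instead, are the immaculate expansions of Defs.
HList : Set
HList = Expansion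

⟦_⟧ : HList → NSym
⟦ P ⟧ w = coeffOf w P

sumQ : List ℚ → ℚ
sumQ = foldr ℚ._+_ 0ℚ

scale : ℚ → HList → HList
scale c = map (λ p → proj₁ p , c ℚ.* proj₂ p)

combine : {A : Set} → (A → ℚ) → (A → HList) → List A → HList
combine c P = concatMap (λ x → scale (c x) (P x))

select-mono : ∀ u w c → (if eqW u w then c else 0ℚ) ≡ c ℚ.* mono u w
select-mono u w c with eqW u w
... | true  = sym (ℚP.*-identityʳ c)
... | false = sym (ℚP.*-zeroʳ c)

select-≢ : ∀ u w c → u ≢ w → (if eqW u w then c else 0ℚ) ≡ 0ℚ
select-≢ u w c u≢w with u ≟W w
... | yes u≡w = ⊥-elim (u≢w u≡w)
... | no _    = refl

⟦∷⟧ : ∀ u c P → ⟦ (u , c) ∷ P ⟧ ≈N c ⊙ mono u ⊕ ⟦ P ⟧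
⟦∷⟧ u c P w = cong (ℚ._+ ⟦ P ⟧ w) (select-mono u w c)

⟦++⟧ : ∀ P Q → ⟦ P ++ Q ⟧ ≈N ⟦ P ⟧ ⊕ ⟦ Q ⟧
⟦++⟧ []            Q w = sym (ℚP.+-identityˡ (⟦ Q ⟧ w))
⟦++⟧ ((u , c) ∷ P) Q w =
  trans (cong (x ℚ.+_) (⟦++⟧ P Q w)) (sym (ℚP.+-assoc x (⟦ P ⟧ w) (⟦ Q ⟧ w)))
  where
    x : ℚ
    x = if eqW u w then c else 0ℚ

⟦scale⟧ : ∀ c P → ⟦ scale c P ⟧ ≈N c ⊙ ⟦ P ⟧
⟦scale⟧ c []            w = sym (ℚP.*-zeroʳ c)
⟦scale⟧ c ((u , a) ∷ P) w =
  trans (cong₂ ℚ._+_ (select-scale (eqW u w)) (⟦scale⟧ c P w))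
        (sym (ℚP.*-distribˡ-+ c _ (⟦ P ⟧ w)))
  where
    select-scale : ∀ b → (if b then c ℚ.* a else 0ℚ) ≡ c ℚ.* (if b then a else 0ℚ)
    select-scale true  = refl
    select-scale false = sym (ℚP.*-zeroʳ c)

⟦combine-∷⟧ : ∀ {A : Set} (c : A → ℚ) (P : A → HList) x L →
              ⟦ combine c P (x ∷ L) ⟧ ≈N c x ⊙ ⟦ P x ⟧ ⊕ ⟦ combine c P L ⟧
⟦combine-∷⟧ c P x L w =
  trans (⟦++⟧ (scale (c x) (P x)) (combine c P L) w)
        (cong (ℚ._+ ⟦ combine c P L ⟧ w) (⟦scale⟧ (c x) (P x) w))

ΣN-combine : ∀ {A : Set} (c : A → ℚ) (F : A → NSym) (P : A → HList) →
             (∀ x → F x ≈N ⟦ P x ⟧) →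
             ∀ L → ΣN (map (λ x → c x ⊙ F x) L) ≈N ⟦ combine c P L ⟧
ΣN-combine c F P F≈P []      w = refl
ΣN-combine c F P F≈P (x ∷ L) w =
  trans (cong₂ ℚ._+_ (cong (c x ℚ.*_) (F≈P x w)) (ΣN-combine c F P F≈P L w))
        (sym (⟦combine-∷⟧ c P x L w))

hlist : List ℤ → HList
hlist a with normVec a
... | nothing = []
... | just w  = (w , 1ℚ) ∷ []

Hvec≈ : ∀ a → Hvec a ≈N ⟦ hlist a ⟧
Hvec≈ a w with normVec a
... | nothing = refl
... | just u  = sym (ℚP.+-identityʳ (mono u w))

-- the vector (α₁+σ₁-ρ₁, …, α_k+σ_k-ρ_k); for ρ the identity it indexes the
-- term of 𝔖_α belonging to σ
shiftVec : List ℕ → List ℕ → List ℕ → List ℤ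
shiftVec α σ ρ = zipWith (λ a p → (+ proj₁ a) ℤ.+ (+ proj₂ a) ℤ.- (+ p)) (zipWith _,_ α σ) ρ

idPerm : ℕ → List ℕ
idPerm k = map suc (upTo k)

termVec : List ℕ → List ℕ → List ℤ
termVec α σ = shiftVec α σ (idPerm (length α))

immList : List ℕ → HList
immList α = combine sign (hlist ∘ termVec α) (perms (length α))

immaculate≈ : ∀ α → immaculate α ≈N ⟦ immList α ⟧
immaculate≈ α = ΣN-combine sign (Hvec ∘ termVec α) (hlist ∘ termVec α) (Hvec≈ ∘ termVec α) (perms (length α))

expList : Expansion → HList
expList = combine proj₂ (immList ∘ proj₁)

evalExp≈ : ∀ e → evalExp e ≈N ⟦ expList e ⟧
evalExp≈ = ΣN-combine proj₂ (immaculate ∘ proj₁) (immList ∘ proj₁) (immaculate≈ ∘ proj₁)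

-- 3. Products of explicit lists

sumQ-linear : ∀ {A : Set} c (h h' : A → ℚ) L →
              sumQ (map (λ x → c ℚ.* h x ℚ.+ h' x) L) ≡ c ℚ.* sumQ (map h L) ℚ.+ sumQ (map h' L)
sumQ-linear c h h' []      = sym (trans (ℚP.+-identityʳ (c ℚ.* 0ℚ)) (ℚP.*-zeroʳ c))
sumQ-linear c h h' (x ∷ L) = trans (cong (c ℚ.* h x ℚ.+ h' x ℚ.+_) (sumQ-linear c h h' L))
  (solve 5 (λ c a b s t → c :* a :+ b :+ (c :* s :+ t) := c :* (a :+ s) :+ (b :+ t))
         refl c (h x) (h' x) (sumQ (map h L)) (sumQ (map h' L)))

sumQ-zero : ∀ {A : Set} (h : A → ℚ) L → All (λ x → h x ≡ 0ℚ) L → sumQ (map h L) ≡ 0ℚ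
sumQ-zero h []      []         = refl
sumQ-zero h (x ∷ L) (hx≡0 ∷ z) = trans (cong₂ ℚ._+_ hx≡0 (sumQ-zero h L z)) (ℚP.+-identityˡ 0ℚ)

⊗-cong : ∀ {f f' g g'} → f ≈N f' → g ≈N g' → f ⊗ g ≈N f' ⊗ g'
⊗-cong f≈ g≈ w = cong sumQ (LP.map-cong (λ p → cong₂ ℚ._*_ (f≈ (proj₁ p)) (g≈ (proj₂ p))) (splits w))

⊗-linearˡ : ∀ c f f' g → (c ⊙ f ⊕ f') ⊗ g ≈N c ⊙ (f ⊗ g) ⊕ f' ⊗ g
⊗-linearˡ c f f' g w =
  trans (cong sumQ (LP.map-cong distrib (splits w))) (sumQ-linear c _ _ (splits w))
  where
    distrib : ∀ p → (c ℚ.* f (proj₁ p) ℚ.+ f' (proj₁ p)) ℚ.* g (proj₂ p)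
                  ≡ c ℚ.* (f (proj₁ p) ℚ.* g (proj₂ p)) ℚ.+ f' (proj₁ p) ℚ.* g (proj₂ p)
    distrib p = solve 4 (λ c a b x → (c :* a :+ b) :* x := c :* (a :* x) :+ b :* x)
                        refl c (f (proj₁ p)) (f' (proj₁ p)) (g (proj₂ p))

⊗-linearʳ : ∀ c f g g' → f ⊗ (c ⊙ g ⊕ g') ≈N c ⊙ (f ⊗ g) ⊕ f ⊗ g'
⊗-linearʳ c f g g' w =
  trans (cong sumQ (LP.map-cong distrib (splits w))) (sumQ-linear c _ _ (splits w))
  where
    distrib : ∀ p → f (proj₁ p) ℚ.* (c ℚ.* g (proj₂ p) ℚ.+ g' (proj₂ p))
                  ≡ c ℚ.* (f (proj₁ p) ℚ.* g (proj₂ p)) ℚ.+ f (proj₁ p) ℚ.* g' (proj₂ p)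
    distrib p = solve 4 (λ c x a b → x :* (c :* a :+ b) := c :* (x :* a) :+ x :* b)
                        refl c (f (proj₁ p)) (g (proj₂ p)) (g' (proj₂ p))

⊗-vanishˡ : ∀ {f} g → (∀ u → f u ≡ 0ℚ) → f ⊗ g ≈N 0N
⊗-vanishˡ {f} g f≡0 w = sumQ-zero _ (splits w)
  (All.universal (λ p → trans (cong (ℚ._* g (proj₂ p)) (f≡0 (proj₁ p))) (ℚP.*-zeroˡ (g (proj₂ p)))) (splits w))

⊗-vanishʳ : ∀ f {g} → (∀ v → g v ≡ 0ℚ) → f ⊗ g ≈N 0N
⊗-vanishʳ f {g} g≡0 w = sumQ-zero _ (splits w)
  (All.universal (λ p → trans (cong (f (proj₁ p) ℚ.*_) (g≡0 (proj₂ p))) (ℚP.*-zeroʳ (f (proj₁ p)))) (splits w))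

-- a split of b ∷ w has empty left part, or its left part starts with b
⊗-∷ : ∀ f g b w → (f ⊗ g) (b ∷ w) ≡ f [] ℚ.* g (b ∷ w) ℚ.+ ((f ∘ (b ∷_)) ⊗ g) w
⊗-∷ f g b w = cong (λ s → f [] ℚ.* g (b ∷ w) ℚ.+ sumQ s) (sym (LP.map-∘ (splits w)))

mono-⊗ : ∀ u v → mono u ⊗ mono v ≈N mono (u ++ v)
mono-⊗ []      v []      = trans (ℚP.+-identityʳ _) (ℚP.*-identityˡ (mono v []))
mono-⊗ (a ∷ u) v []      = trans (ℚP.+-identityʳ _) (ℚP.*-zeroˡ (mono v []))
mono-⊗ []      v (b ∷ w) = begin
    (mono [] ⊗ mono v) (b ∷ w)
  ≡⟨ ⊗-∷ (mono []) (mono v) b w ⟩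
    1ℚ ℚ.* mono v (b ∷ w) ℚ.+ ((mono [] ∘ (b ∷_)) ⊗ mono v) w
  ≡⟨ cong₂ ℚ._+_ (ℚP.*-identityˡ (mono v (b ∷ w))) (⊗-vanishˡ (mono v) (λ _ → refl) w) ⟩
    mono v (b ∷ w) ℚ.+ 0ℚ
  ≡⟨ ℚP.+-identityʳ (mono v (b ∷ w)) ⟩
    mono v (b ∷ w)
  ∎
  where open ≡-Reasoning
mono-⊗ (a ∷ u) v (b ∷ w) = begin
    (mono (a ∷ u) ⊗ mono v) (b ∷ w)
  ≡⟨ ⊗-∷ (mono (a ∷ u)) (mono v) b w ⟩
    0ℚ ℚ.* mono v (b ∷ w) ℚ.+ ((mono (a ∷ u) ∘ (b ∷_)) ⊗ mono v) w
  ≡⟨ trans (cong (ℚ._+ rest) (ℚP.*-zeroˡ (mono v (b ∷ w)))) (ℚP.+-identityˡ rest) ⟩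
    ((mono (a ∷ u) ∘ (b ∷_)) ⊗ mono v) w
  ≡⟨ tail (a ℕ.≟ b) ⟩
    mono (a ∷ u ++ v) (b ∷ w)
  ∎
  where
    open ≡-Reasoning
    rest : ℚ
    rest = ((mono (a ∷ u) ∘ (b ∷_)) ⊗ mono v) w
    tail : Dec (a ≡ b) → ((mono (a ∷ u) ∘ (b ∷_)) ⊗ mono v) w ≡ mono (a ∷ u ++ v) (b ∷ w)
    tail (yes refl) = trans (⊗-cong {g = mono v} (mono-cons a u) (λ _ → refl) w)
                            (trans (mono-⊗ u v w) (sym (mono-cons a (u ++ v) w)))
    tail (no a≢b)   = trans (⊗-vanishˡ (mono v) (λ x → mono-head u x a≢b) w)
                            (sym (mono-head (u ++ v) w a≢b))

prefix : List ℕ → HList → HList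
prefix u = map (λ p → u ++ proj₁ p , proj₂ p)

mono-⊗-⟦⟧ : ∀ u Q → mono u ⊗ ⟦ Q ⟧ ≈N ⟦ prefix u Q ⟧
mono-⊗-⟦⟧ u []            w = ⊗-vanishʳ (mono u) (λ _ → refl) w
mono-⊗-⟦⟧ u ((v , b) ∷ Q) w = begin
    (mono u ⊗ ⟦ (v , b) ∷ Q ⟧) w
  ≡⟨ ⊗-cong {f = mono u} (λ _ → refl) (⟦∷⟧ v b Q) w ⟩
    (mono u ⊗ (b ⊙ mono v ⊕ ⟦ Q ⟧)) w
  ≡⟨ ⊗-linearʳ b (mono u) (mono v) ⟦ Q ⟧ w ⟩
    b ℚ.* (mono u ⊗ mono v) w ℚ.+ (mono u ⊗ ⟦ Q ⟧) w
  ≡⟨ cong₂ (λ x y → b ℚ.* x ℚ.+ y) (mono-⊗ u v w) (mono-⊗-⟦⟧ u Q w) ⟩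
    b ℚ.* mono (u ++ v) w ℚ.+ ⟦ prefix u Q ⟧ w
  ≡⟨ sym (⟦∷⟧ (u ++ v) b (prefix u Q) w) ⟩
    ⟦ prefix u ((v , b) ∷ Q) ⟧ w
  ∎
  where open ≡-Reasoning

mulList : HList → HList → HList
mulList P Q = combine proj₂ (λ p → prefix (proj₁ p) Q) P

⟦⟧-⊗-⟦⟧ : ∀ P Q → ⟦ P ⟧ ⊗ ⟦ Q ⟧ ≈N ⟦ mulList P Q ⟧
⟦⟧-⊗-⟦⟧ []            Q w = ⊗-vanishˡ ⟦ Q ⟧ (λ _ → refl) w
⟦⟧-⊗-⟦⟧ ((u , a) ∷ P) Q w = begin
    (⟦ (u , a) ∷ P ⟧ ⊗ ⟦ Q ⟧) w
  ≡⟨ ⊗-cong {g = ⟦ Q ⟧} (⟦∷⟧ u a P) (λ _ → refl) w ⟩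
    ((a ⊙ mono u ⊕ ⟦ P ⟧) ⊗ ⟦ Q ⟧) w
  ≡⟨ ⊗-linearˡ a (mono u) ⟦ P ⟧ ⟦ Q ⟧ w ⟩
    a ℚ.* (mono u ⊗ ⟦ Q ⟧) w ℚ.+ (⟦ P ⟧ ⊗ ⟦ Q ⟧) w
  ≡⟨ cong₂ (λ x y → a ℚ.* x ℚ.+ y) (mono-⊗-⟦⟧ u Q w) (⟦⟧-⊗-⟦⟧ P Q w) ⟩
    a ℚ.* ⟦ prefix u Q ⟧ w ℚ.+ ⟦ mulList P Q ⟧ w
  ≡⟨ sym (⟦combine-∷⟧ proj₂ (λ p → prefix (proj₁ p) Q) (u , a) P w) ⟩
    ⟦ mulList ((u , a) ∷ P) Q ⟧ w
  ∎
  where open ≡-Reasoning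

-- 4. Deciding equality of explicit lists with tries

-- A trie of rationals indexed by words: the label reached along the path w
-- is the coefficient of H_w.  Inserting all entries of a list normalises it.
data Trie : Set where
  node : ℚ → List (ℕ × Trie) → Trie

emptyT : Trie
emptyT = node 0ℚ []

mutual
  insertT : List ℕ → ℚ → Trie → Trie
  insertT []      c (node r cs) = node (c ℚ.+ r) cs
  insertT (a ∷ u) c (node r cs) = node r (insertC a u c cs)

  insertC : ℕ → List ℕ → ℚ → List (ℕ × Trie) → List (ℕ × Trie)
  insertC a u c []             = (a , insertT u c emptyT) ∷ []
  insertC a u c ((b , t) ∷ cs) with a ℕ.≟ b
  ... | yes _ = (b , insertT u c t) ∷ cs
  ... | no _  = (b , t) ∷ insertC a u c cs

buildT : HList → Trie
buildT = foldr (λ p t → insertT (proj₁ p) (proj₂ p) t) emptyT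

mutual
  ⟦_⟧T : Trie → NSym
  ⟦ node r cs ⟧T []      = r
  ⟦ node r cs ⟧T (a ∷ w) = lookupC cs a w

  lookupC : List (ℕ × Trie) → ℕ → List ℕ → ℚ
  lookupC []             a w = 0ℚ
  lookupC ((b , t) ∷ cs) a w with a ℕ.≟ b
  ... | yes _ = ⟦ t ⟧T w
  ... | no _  = lookupC cs a w

mutual
  isZeroT : Trie → Bool
  isZeroT (node r cs) = does (r ℚP.≟ 0ℚ) ∧ isZeroC cs

  isZeroC : List (ℕ × Trie) → Bool
  isZeroC []             = true
  isZeroC ((_ , t) ∷ cs) = isZeroT t ∧ isZeroC cs

⟦emptyT⟧ : ⟦ emptyT ⟧T ≈N 0N
⟦emptyT⟧ []      = refl
⟦emptyT⟧ (a ∷ w) = refl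

add-vanishing : ∀ c {m} x → m ≡ 0ℚ → x ≡ c ℚ.* m ℚ.+ x
add-vanishing c x refl = sym (trans (cong (ℚ._+ x) (ℚP.*-zeroʳ c)) (ℚP.+-identityˡ x))

mutual
  ⟦insertT⟧ : ∀ u c t → ⟦ insertT u c t ⟧T ≈N c ⊙ mono u ⊕ ⟦ t ⟧T
  ⟦insertT⟧ []      c (node r cs) []      = cong (ℚ._+ r) (sym (ℚP.*-identityʳ c))
  ⟦insertT⟧ []      c (node r cs) (a ∷ w) = add-vanishing c (lookupC cs a w) refl
  ⟦insertT⟧ (a ∷ u) c (node r cs) []      = add-vanishing c r refl
  ⟦insertT⟧ (a ∷ u) c (node r cs) (b ∷ w) = lookup-insertC a u c cs b w

  lookup-insertC : ∀ a u c cs b w →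
                   lookupC (insertC a u c cs) b w ≡ c ℚ.* mono (a ∷ u) (b ∷ w) ℚ.+ lookupC cs b w
  lookup-insertC a u c [] b w with b ℕ.≟ a
  ... | yes refl = trans (⟦insertT⟧ u c emptyT w)
                         (cong₂ ℚ._+_ (cong (c ℚ.*_) (sym (mono-cons b u w))) (⟦emptyT⟧ w))
  ... | no b≢a   = add-vanishing c 0ℚ (mono-head u w (b≢a ∘ sym))
  lookup-insertC a u c ((b' , t) ∷ cs) b w with a ℕ.≟ b'
  lookup-insertC a u c ((a , t) ∷ cs) b w | yes refl with b ℕ.≟ a
  ... | yes refl = trans (⟦insertT⟧ u c t w) (cong (λ m → c ℚ.* m ℚ.+ ⟦ t ⟧T w) (sym (mono-cons b u w)))
  ... | no b≢a   = add-vanishing c (lookupC cs b w) (mono-head u w (b≢a ∘ sym))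
  lookup-insertC a u c ((b' , t) ∷ cs) b w | no a≢b' with b ℕ.≟ b'
  ... | yes refl = add-vanishing c (⟦ t ⟧T w) (mono-head u w a≢b')
  ... | no _     = lookup-insertC a u c cs b w

⟦buildT⟧ : ∀ P → ⟦ buildT P ⟧T ≈N ⟦ P ⟧
⟦buildT⟧ []            w = ⟦emptyT⟧ w
⟦buildT⟧ ((u , c) ∷ P) w =
  trans (⟦insertT⟧ u c (buildT P) w) (trans (cong (c ℚ.* mono u w ℚ.+_) (⟦buildT⟧ P w)) (sym (⟦∷⟧ u c P w)))

∧-true-left : ∀ x {y} → (x ∧ y) ≡ true → x ≡ true
∧-true-left true _ = refl

∧-true-right : ∀ x {y} → (x ∧ y) ≡ true → y ≡ true
∧-true-right true y≡true = y≡true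

mutual
  isZeroT-sound : ∀ t → isZeroT t ≡ true → ⟦ t ⟧T ≈N 0N
  isZeroT-sound (node r cs) z []      with r ℚP.≟ 0ℚ
  ... | yes r≡0 = r≡0
  isZeroT-sound (node r cs) z (a ∷ w) = isZeroC-sound cs (∧-true-right (does (r ℚP.≟ 0ℚ)) z) a w

  isZeroC-sound : ∀ cs → isZeroC cs ≡ true → ∀ a w → lookupC cs a w ≡ 0ℚ
  isZeroC-sound []             z a w = refl
  isZeroC-sound ((b , t) ∷ cs) z a w with a ℕ.≟ b
  ... | yes _ = isZeroT-sound t (∧-true-left (isZeroT t) z) w
  ... | no _  = isZeroC-sound cs (∧-true-right (isZeroT t) z) a w

difference-zero : ∀ x y → x ℚ.+ ℚ.- 1ℚ ℚ.* y ≡ 0ℚ → x ≡ y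
difference-zero x y x-y≡0 = begin
    x                           ≡⟨ solve 2 (λ x y → x := (x :+ con (ℚ.- 1ℚ) :* y) :+ y) refl x y ⟩
    x ℚ.+ ℚ.- 1ℚ ℚ.* y ℚ.+ y    ≡⟨ cong (ℚ._+ y) x-y≡0 ⟩
    0ℚ ℚ.+ y                    ≡⟨ ℚP.+-identityˡ y ⟩
    y                           ∎
  where open ≡-Reasoning

TrieCertificate : HList → HList → Set
TrieCertificate P Q = isZeroT (buildT (P ++ scale (ℚ.- 1ℚ) Q)) ≡ true

trie-equal : ∀ P Q → TrieCertificate P Q → ⟦ P ⟧ ≈N ⟦ Q ⟧
trie-equal P Q z w = difference-zero (⟦ P ⟧ w) (⟦ Q ⟧ w) (begin
    ⟦ P ⟧ w ℚ.+ ℚ.- 1ℚ ℚ.* ⟦ Q ⟧ w    ≡⟨ cong (⟦ P ⟧ w ℚ.+_) (sym (⟦scale⟧ (ℚ.- 1ℚ) Q w)) ⟩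
    ⟦ P ⟧ w ℚ.+ ⟦ R ⟧ w               ≡⟨ sym (⟦++⟧ P R w) ⟩
    ⟦ P ++ R ⟧ w                      ≡⟨ sym (⟦buildT⟧ (P ++ R) w) ⟩
    ⟦ buildT (P ++ R) ⟧T w            ≡⟨ isZeroT-sound (buildT (P ++ R)) z w ⟩
    0ℚ                                ∎)
  where
    open ≡-Reasoning
    R : HList
    R = scale (ℚ.- 1ℚ) Q

-- 5. Triangularity of the immaculate functions

_<ₗ_ : List ℕ → List ℕ → Set
_<ₗ_ = Lex-< _≡_ ℕ._<_

<ₗ-irrefl : ∀ {u} → ¬ (u <ₗ u)
<ₗ-irrefl = <-irreflexive ℕP.<-irrefl (Pointwise.refl refl)

<ₗ-trans : ∀ {u v w} → u <ₗ v → v <ₗ w → u <ₗ w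
<ₗ-trans = <-transitive isEquivalence (resp₂ ℕ._<_) ℕP.<-trans

_≤ₗ_ : List ℕ → List ℕ → Set
u ≤ₗ v = u ≡ v ⊎ u <ₗ v

≤ₗ-<ₗ-trans : ∀ {u v w} → u ≤ₗ v → v <ₗ w → u <ₗ w
≤ₗ-<ₗ-trans (inj₁ refl) v<w = v<w
≤ₗ-<ₗ-trans (inj₂ u<v)  v<w = <ₗ-trans u<v v<w

≤ₗ-trans : ∀ {u v w} → u ≤ₗ v → v ≤ₗ w → u ≤ₗ w
≤ₗ-trans u≤v (inj₁ refl) = u≤v
≤ₗ-trans u≤v (inj₂ v<w)  = inj₂ (≤ₗ-<ₗ-trans u≤v v<w)

data _≻_ : List ℕ → List ℕ → Set where
  head-≻ : ∀ {x y xs ys} → y ℕ.< x → (x ∷ xs) ≻ (y ∷ ys)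
  tail-≻ : ∀ {x xs ys} → xs ≻ ys → (x ∷ xs) ≻ (x ∷ ys)

sumQ-++ : ∀ xs ys → sumQ (xs ++ ys) ≡ sumQ xs ℚ.+ sumQ ys
sumQ-++ []       ys = sym (ℚP.+-identityˡ (sumQ ys))
sumQ-++ (x ∷ xs) ys = trans (cong (x ℚ.+_) (sumQ-++ xs ys)) (sym (ℚP.+-assoc x (sumQ xs) (sumQ ys)))

sumQ-concatMap : ∀ {A B : Set} (g : B → ℚ) (f : A → List B) L →
                 sumQ (map g (concatMap f L)) ≡ sumQ (map (λ x → sumQ (map g (f x))) L)
sumQ-concatMap g f []      = refl
sumQ-concatMap g f (x ∷ L) =
  trans (cong sumQ (LP.map-++ g (f x) (concatMap f L)))
        (trans (sumQ-++ (map g (f x)) (map g (concatMap f L)))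
               (cong (sumQ (map g (f x)) ℚ.+_) (sumQ-concatMap g f L)))

insertAll-≻ : ∀ x σ ρ → All (ℕ._< x) ρ → σ ≻ ρ → All (_≻ (ρ ∷ʳ x)) (insertAll x σ)
insertAll-≻ x (y ∷ σ) (r ∷ ρ) (r<x ∷ _) (head-≻ r<y) =
  head-≻ r<x ∷ AllP.map⁺ (All.universal (λ _ → head-≻ r<y) (insertAll x σ))
insertAll-≻ x (y ∷ σ) (y ∷ ρ) (y<x ∷ ρ<x) (tail-≻ σ≻ρ) =
  head-≻ y<x ∷ AllP.map⁺ (All.map tail-≻ (insertAll-≻ x σ ρ ρ<x σ≻ρ))

-- among the insertions of a maximum x into ρ only ρ ∷ʳ x is not above ρ ∷ʳ x
insertAll-sum : ∀ x ρ (g : List ℕ → ℚ) → All (ℕ._< x) ρ →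
                (∀ τ → τ ≻ (ρ ∷ʳ x) → g τ ≡ 0ℚ) → sumQ (map g (insertAll x ρ)) ≡ g (ρ ∷ʳ x)
insertAll-sum x []      g []          g-vanishes = ℚP.+-identityʳ (g (x ∷ []))
insertAll-sum x (r ∷ ρ) g (r<x ∷ ρ<x) g-vanishes = begin
    g (x ∷ r ∷ ρ) ℚ.+ sumQ (map g (map (r ∷_) (insertAll x ρ)))
  ≡⟨ cong₂ ℚ._+_ (g-vanishes (x ∷ r ∷ ρ) (head-≻ r<x)) (cong sumQ (sym (LP.map-∘ (insertAll x ρ)))) ⟩
    0ℚ ℚ.+ sumQ (map (g ∘ (r ∷_)) (insertAll x ρ))
  ≡⟨ ℚP.+-identityˡ _ ⟩
    sumQ (map (g ∘ (r ∷_)) (insertAll x ρ))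
  ≡⟨ insertAll-sum x ρ (g ∘ (r ∷_)) ρ<x (λ τ τ≻ → g-vanishes (r ∷ τ) (tail-≻ τ≻)) ⟩
    g (r ∷ ρ ∷ʳ x)
  ∎
  where open ≡-Reasoning

idPerm-suc : ∀ k → idPerm (suc k) ≡ idPerm k ∷ʳ suc k
idPerm-suc k = trans (cong (map suc) (sym (LP.upTo-∷ʳ k))) (LP.map-++ suc (upTo k) (k ∷ []))

idPerm-< : ∀ k → All (ℕ._< suc k) (idPerm k)
idPerm-< zero    = []
idPerm-< (suc k) = subst (All (ℕ._< suc (suc k))) (sym (idPerm-suc k))
  (AllP.∷ʳ⁺ (All.map ℕP.m<n⇒m<1+n (idPerm-< k)) (ℕP.n<1+n (suc k)))

length-idPerm : ∀ k → length (idPerm k) ≡ k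
length-idPerm k = trans (LP.length-map suc (upTo k)) (LP.length-upTo k)

permutation-sum : ∀ k (g : List ℕ → ℚ) → (∀ σ → σ ≻ idPerm k → g σ ≡ 0ℚ) →
                  sumQ (map g (perms k)) ≡ g (idPerm k)
permutation-sum zero    g g-vanishes = ℚP.+-identityʳ (g [])
permutation-sum (suc k) g g-vanishes = begin
    sumQ (map g (concatMap (insertAll (suc k)) (perms k)))
  ≡⟨ sumQ-concatMap g (insertAll (suc k)) (perms k) ⟩
    sumQ (map h (perms k))
  ≡⟨ permutation-sum k h h-vanishes ⟩
    h (idPerm k)
  ≡⟨ insertAll-sum (suc k) (idPerm k) g (idPerm-< k) g-vanishes′ ⟩
    g (idPerm k ∷ʳ suc k)
  ≡⟨ cong g (sym (idPerm-suc k)) ⟩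
    g (idPerm (suc k))
  ∎
  where
    open ≡-Reasoning
    h : List ℕ → ℚ
    h σ = sumQ (map g (insertAll (suc k) σ))
    g-vanishes′ : ∀ τ → τ ≻ (idPerm k ∷ʳ suc k) → g τ ≡ 0ℚ
    g-vanishes′ τ τ≻ = g-vanishes τ (subst (τ ≻_) (sym (idPerm-suc k)) τ≻)
    h-vanishes : ∀ σ → σ ≻ idPerm k → h σ ≡ 0ℚ
    h-vanishes σ σ≻ = sumQ-zero g (insertAll (suc k) σ)
      (All.map (g-vanishes′ _) (insertAll-≻ (suc k) σ (idPerm k) (idPerm-< k) σ≻))

shifted-entry : ∀ a s r → r ℕ.≤ s → (+ a) ℤ.+ (+ s) ℤ.- (+ r) ≡ + (a ℕ.+ (s ℕ.∸ r))
shifted-entry a s r r≤s =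
  trans (ℤP.[+m]-[+n]≡m⊖n (a ℕ.+ s) r)
        (trans (ℤP.⊖-≥ (ℕP.≤-trans r≤s (ℕP.m≤n+m s a))) (cong +_ (ℕP.+-∸-assoc a r≤s)))

unshifted-entry : ∀ a r → (+ a) ℤ.+ (+ r) ℤ.- (+ r) ≡ + a
unshifted-entry a r =
  trans (shifted-entry a r r ℕP.≤-refl) (cong +_ (trans (cong (a ℕ.+_) (ℕP.n∸n≡0 r)) (ℕP.+-identityʳ a)))

consM : ℕ → Maybe (List ℕ) → Maybe (List ℕ)
consM n = mapMaybe (n ∷_)

normVec-suc : ∀ n a → normVec (+ suc n ∷ a) ≡ consM (suc n) (normVec a)
normVec-suc n a with normVec a
... | nothing = refl
... | just w  = refl

-- the diagonal term: shifting δ by ρ and back gives H_δ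
normVec-diagonal : ∀ δ ρ → IsComposition δ → length δ ≡ length ρ → normVec (shiftVec δ ρ ρ) ≡ just δ
normVec-diagonal []           []      []      _   = refl
normVec-diagonal (suc d ∷ δ) (r ∷ ρ) (_ ∷ pδ) len
  rewrite unshifted-entry (suc d) r | normVec-suc d (shiftVec δ ρ ρ)
        | normVec-diagonal δ ρ pδ (ℕP.suc-injective len) = refl

data Above (δ : List ℕ) : Maybe (List ℕ) → Set where
  none : Above δ nothing
  some : ∀ {u} → δ <ₗ u → Above δ (just u)

above-head : ∀ {x y δ m} → x ℕ.< y → Above (x ∷ δ) (consM y m)
above-head {m = nothing} x<y = none
above-head {m = just w}  x<y = some (this x<y)

above-tail : ∀ {x δ m} → Above δ m → Above (x ∷ δ) (consM x m)
above-tail none       = none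
above-tail (some δ<u) = some (next refl δ<u)

-- the off-diagonal terms: σ ≻ ρ gives a monomial above δ (or none)
normVec-above : ∀ δ σ ρ → IsComposition δ → length δ ≡ length ρ → σ ≻ ρ →
                Above δ (normVec (shiftVec δ σ ρ))
normVec-above [] (s ∷ σ) (r ∷ ρ) _ () _
normVec-above (suc d ∷ δ) (s ∷ σ) (r ∷ ρ) (_ ∷ pδ) len (head-≻ r<s)
  rewrite shifted-entry (suc d) s r (ℕP.<⇒≤ r<s) | normVec-suc (d ℕ.+ (s ℕ.∸ r)) (shiftVec δ σ ρ) =
    above-head {m = normVec (shiftVec δ σ ρ)} (s≤s (ℕP.m<m+n d (ℕP.m<n⇒0<n∸m r<s)))
normVec-above (suc d ∷ δ) (s ∷ σ) (s ∷ ρ) (_ ∷ pδ) len (tail-≻ σ≻ρ)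
  rewrite unshifted-entry (suc d) s | normVec-suc d (shiftVec δ σ ρ) =
    above-tail (normVec-above δ σ ρ pδ (ℕP.suc-injective len) σ≻ρ)

Hvec-just : ∀ a {u} → normVec a ≡ just u → Hvec a ≈N mono u
Hvec-just a eq w with normVec a
Hvec-just a refl w | just u = refl

Hvec-above : ∀ a {δ} μ → Above δ (normVec a) → μ ≤ₗ δ → Hvec a μ ≡ 0ℚ
Hvec-above a μ above μ≤δ with normVec a | above
... | nothing | none       = refl
... | just u  | some δ<u   = mono-≢ u μ (λ { refl → <ₗ-irrefl (≤ₗ-<ₗ-trans μ≤δ δ<u) })

ΣN-at : ∀ fs w → ΣN fs w ≡ sumQ (map (λ f → f w) fs)
ΣN-at []       w = refl
ΣN-at (f ∷ fs) w = cong (f w ℚ.+_) (ΣN-at fs w)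

-- 𝔖_δ = ±H_δ + (monomials lexicographically above δ)
immaculate-triangular : ∀ δ μ → IsComposition δ → μ ≤ₗ δ →
                        immaculate δ μ ≡ sign (idPerm (length δ)) ℚ.* mono δ μ
immaculate-triangular δ μ pδ μ≤δ = begin
    immaculate δ μ
  ≡⟨ ΣN-at (map (λ σ → sign σ ⊙ Hvec (termVec δ σ)) (perms k)) μ ⟩
    sumQ (map (λ f → f μ) (map (λ σ → sign σ ⊙ Hvec (termVec δ σ)) (perms k)))
  ≡⟨ cong sumQ (sym (LP.map-∘ (perms k))) ⟩
    sumQ (map term (perms k))
  ≡⟨ permutation-sum k term term-vanishes ⟩
    term (idPerm k)
  ≡⟨ cong (sign (idPerm k) ℚ.*_) (Hvec-just (termVec δ (idPerm k)) (normVec-diagonal δ (idPerm k) pδ len) μ) ⟩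
    sign (idPerm k) ℚ.* mono δ μ
  ∎
  where
    open ≡-Reasoning
    k : ℕ
    k = length δ
    len : length δ ≡ length (idPerm k)
    len = sym (length-idPerm k)
    term : List ℕ → ℚ
    term σ = sign σ ℚ.* Hvec (termVec δ σ) μ
    term-vanishes : ∀ σ → σ ≻ idPerm k → term σ ≡ 0ℚ
    term-vanishes σ σ≻ = trans (cong (sign σ ℚ.*_)
                                 (Hvec-above (termVec δ σ) μ (normVec-above δ σ (idPerm k) pδ len σ≻) μ≤δ))
                               (ℚP.*-zeroʳ (sign σ))

-- 6. Linear independence of the immaculate functions

<ₗ-compare : ∀ u v → u <ₗ v ⊎ u ≡ v ⊎ v <ₗ u
<ₗ-compare u v with <-compare sym ℕP.<-cmp u v
... | tri< u<v _ _ = inj₁ u<v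
... | tri≈ _ u≋v _ = inj₂ (inj₁ (Pointwise.Pointwise-≡⇒≡ u≋v))
... | tri> _ _ v<u = inj₂ (inj₂ v<u)

HasKey : List ℕ → Expansion → Set
HasKey μ = Any (λ p → proj₁ p ≡ μ)

KeysAbove : List ℕ → Expansion → Set
KeysAbove μ = All (λ p → μ ≤ₗ proj₁ p)

least-key : ∀ δ c d → ∃[ μ ] HasKey μ ((δ , c) ∷ d) × KeysAbove μ ((δ , c) ∷ d)
least-key δ c []               = δ , here refl , inj₁ refl ∷ []
least-key δ c ((δ′ , c′) ∷ d) with least-key δ′ c′ d
... | μ , μ∈ , μ≤ with <ₗ-compare δ μ
...   | inj₁ δ<μ         = δ , here refl , inj₁ refl ∷ All.map (≤ₗ-trans (inj₂ δ<μ)) μ≤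
...   | inj₂ (inj₁ refl) = δ , here refl , inj₁ refl ∷ μ≤
...   | inj₂ (inj₂ μ<δ)  = μ , there μ∈ , inj₂ μ<δ ∷ μ≤

evalExp-least : ∀ μ d → ValidExpansion d → KeysAbove μ d →
                evalExp d μ ≡ sign (idPerm (length μ)) ℚ.* coeffOf μ d
evalExp-least μ []            []        []          = sym (ℚP.*-zeroʳ (sign (idPerm (length μ))))
evalExp-least μ ((δ , c) ∷ d) (pδ ∷ pd) (μ≤δ ∷ μ≤d) with δ ≟W μ
... | yes refl = begin
    c ℚ.* immaculate δ δ ℚ.+ evalExp d δ
  ≡⟨ cong₂ ℚ._+_ (cong (c ℚ.*_) (immaculate-triangular δ δ pδ μ≤δ)) (evalExp-least δ d pd μ≤d) ⟩
    c ℚ.* (s ℚ.* mono δ δ) ℚ.+ s ℚ.* coeffOf δ d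
  ≡⟨ cong (λ m → c ℚ.* (s ℚ.* m) ℚ.+ s ℚ.* coeffOf δ d) (mono-≡ δ δ refl) ⟩
    c ℚ.* (s ℚ.* 1ℚ) ℚ.+ s ℚ.* coeffOf δ d
  ≡⟨ solve 3 (λ c s x → c :* (s :* con 1ℚ) :+ s :* x := s :* (c :+ x)) refl c s (coeffOf δ d) ⟩
    s ℚ.* (c ℚ.+ coeffOf δ d)
  ∎
  where
    open ≡-Reasoning
    s : ℚ
    s = sign (idPerm (length δ))
... | no δ≢μ = begin
    c ℚ.* immaculate δ μ ℚ.+ evalExp d μ
  ≡⟨ cong₂ ℚ._+_ (cong (c ℚ.*_) (immaculate-triangular δ μ pδ μ≤δ)) (evalExp-least μ d pd μ≤d) ⟩
    c ℚ.* (s′ ℚ.* mono δ μ) ℚ.+ s ℚ.* coeffOf μ d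
  ≡⟨ cong (λ m → c ℚ.* (s′ ℚ.* m) ℚ.+ s ℚ.* coeffOf μ d) (mono-≢ δ μ δ≢μ) ⟩
    c ℚ.* (s′ ℚ.* 0ℚ) ℚ.+ s ℚ.* coeffOf μ d
  ≡⟨ solve 4 (λ c s′ s x → c :* (s′ :* con 0ℚ) :+ s :* x := s :* (con 0ℚ :+ x)) refl c s′ s (coeffOf μ d) ⟩
    s ℚ.* (0ℚ ℚ.+ coeffOf μ d)
  ∎
  where
    open ≡-Reasoning
    s s′ : ℚ
    s = sign (idPerm (length μ))
    s′ = sign (idPerm (length δ))

sign-±1 : ∀ σ → sign σ ≡ 1ℚ ⊎ sign σ ≡ ℚ.- 1ℚ
sign-±1 σ = byCases _
  where
    byCases : ∀ b → (if b then 1ℚ else ℚ.- 1ℚ) ≡ 1ℚ ⊎ (if b then 1ℚ else ℚ.- 1ℚ) ≡ ℚ.- 1ℚ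
    byCases true  = inj₁ refl
    byCases false = inj₂ refl

sign-cancel : ∀ σ x → sign σ ℚ.* x ≡ 0ℚ → x ≡ 0ℚ
sign-cancel σ x sx≡0 with sign-±1 σ
... | inj₁ s≡1  = trans (sym (ℚP.*-identityˡ x)) (trans (cong (ℚ._* x) (sym s≡1)) sx≡0)
... | inj₂ s≡-1 = begin
    x                            ≡⟨ solve 1 (λ x → x := con (ℚ.- 1ℚ) :* (con (ℚ.- 1ℚ) :* x)) refl x ⟩
    ℚ.- 1ℚ ℚ.* (ℚ.- 1ℚ ℚ.* x)    ≡⟨ cong (λ s → ℚ.- 1ℚ ℚ.* (s ℚ.* x)) (sym s≡-1) ⟩
    ℚ.- 1ℚ ℚ.* (sign σ ℚ.* x)    ≡⟨ cong (ℚ.- 1ℚ ℚ.*_) sx≡0 ⟩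
    ℚ.- 1ℚ ℚ.* 0ℚ                ≡⟨ ℚP.*-zeroʳ (ℚ.- 1ℚ) ⟩
    0ℚ                           ∎
  where open ≡-Reasoning

keep? : ∀ μ (p : List ℕ × ℚ) → Dec (proj₁ p ≢ μ)
keep? μ p = ¬? (proj₁ p ≟W μ)

removeKey : List ℕ → Expansion → Expansion
removeKey μ = filter (keep? μ)

evalExp-removeKey : ∀ μ d → evalExp d ≈N evalExp (removeKey μ d) ⊕ coeffOf μ d ⊙ immaculate μ
evalExp-removeKey μ []            w = sym (trans (ℚP.+-identityˡ _) (ℚP.*-zeroˡ (immaculate μ w)))
evalExp-removeKey μ ((δ , c) ∷ d) w with δ ≟W μ
... | yes refl = trans (cong (c ℚ.* immaculate δ w ℚ.+_) (evalExp-removeKey δ d w))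
  (solve 4 (λ c i e x → c :* i :+ (e :+ x :* i) := e :+ (c :+ x) :* i)
         refl c (immaculate δ w) (evalExp (removeKey δ d) w) (coeffOf δ d))
... | no _     = trans (cong (c ℚ.* immaculate δ w ℚ.+_) (evalExp-removeKey μ d w))
  (solve 5 (λ c i e x j → c :* i :+ (e :+ x :* j) := (c :* i :+ e) :+ (con 0ℚ :+ x) :* j)
         refl c (immaculate δ w) (evalExp (removeKey μ d) w) (coeffOf μ d) (immaculate μ w))

coeffOf-removeKey : ∀ μ γ d → γ ≢ μ → coeffOf γ (removeKey μ d) ≡ coeffOf γ d
coeffOf-removeKey μ γ []            γ≢μ = refl
coeffOf-removeKey μ γ ((δ , c) ∷ d) γ≢μ with δ ≟W μ
... | yes refl = trans (coeffOf-removeKey δ γ d γ≢μ)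
                       (sym (trans (cong (ℚ._+ coeffOf γ d) (select-≢ δ γ c (γ≢μ ∘ sym)))
                                   (ℚP.+-identityˡ (coeffOf γ d))))
... | no _     = cong ((if eqW δ γ then c else 0ℚ) ℚ.+_) (coeffOf-removeKey μ γ d γ≢μ)

-- an expansion of zero has only zero coefficients; the induction removes the
-- least composition, whose coefficient is read off by `evalExp-least`
independent : ∀ n d → length d ℕ.≤ n → ValidExpansion d → evalExp d ≈N 0N →
              ∀ γ → coeffOf γ d ≡ 0ℚ
independent n       []             _   _     _   γ = refl
independent zero    (_ ∷ _)        ()  _     _   γ
independent (suc n) ((δ , c) ∷ d′) len valid d≈0 with least-key δ c d′
... | μ , μ∈d , μ≤d = coefficient
  where
    d d-μ : Expansion
    d = (δ , c) ∷ d′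
    d-μ = removeKey μ d
    cμ≡0 : coeffOf μ d ≡ 0ℚ
    cμ≡0 = sign-cancel (idPerm (length μ)) (coeffOf μ d)
                       (trans (sym (evalExp-least μ d valid μ≤d)) (d≈0 μ))
    rest≈0 : evalExp d-μ ≈N 0N
    rest≈0 w = begin
        evalExp d-μ w                                   ≡⟨ sym (ℚP.+-identityʳ (evalExp d-μ w)) ⟩
        evalExp d-μ w ℚ.+ 0ℚ                            ≡⟨ cong (evalExp d-μ w ℚ.+_) (sym (ℚP.*-zeroˡ (immaculate μ w))) ⟩
        evalExp d-μ w ℚ.+ 0ℚ ℚ.* immaculate μ w         ≡⟨ cong (λ x → evalExp d-μ w ℚ.+ x ℚ.* immaculate μ w) (sym cμ≡0) ⟩
        evalExp d-μ w ℚ.+ coeffOf μ d ℚ.* immaculate μ w ≡⟨ sym (evalExp-removeKey μ d w) ⟩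
        evalExp d w                                     ≡⟨ d≈0 w ⟩
        0ℚ                                              ∎
      where open ≡-Reasoning
    shorter : length d-μ ℕ.≤ n
    shorter = ℕP.≤-pred (ℕP.≤-trans (LP.filter-notAll (keep? μ) d (Any.map (λ δ≡μ δ≢μ → δ≢μ δ≡μ) μ∈d)) len)
    coefficient : ∀ γ → coeffOf γ d ≡ 0ℚ
    coefficient γ with γ ≟W μ
    ... | yes refl = cμ≡0
    ... | no γ≢μ   = trans (sym (coeffOf-removeKey μ γ d γ≢μ))
                           (independent n d-μ shorter (AllP.filter⁺ (keep? μ) valid) rest≈0 γ)

evalExp-++ : ∀ e f → evalExp (e ++ f) ≈N evalExp e ⊕ evalExp f
evalExp-++ []            f w = sym (ℚP.+-identityˡ (evalExp f w))
evalExp-++ ((δ , c) ∷ e) f w =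
  trans (cong (c ℚ.* immaculate δ w ℚ.+_) (evalExp-++ e f w))
        (sym (ℚP.+-assoc (c ℚ.* immaculate δ w) (evalExp e w) (evalExp f w)))

evalExp-scale : ∀ a e → evalExp (scale a e) ≈N a ⊙ evalExp e
evalExp-scale a []            w = sym (ℚP.*-zeroʳ a)
evalExp-scale a ((δ , c) ∷ e) w =
  trans (cong (a ℚ.* c ℚ.* immaculate δ w ℚ.+_) (evalExp-scale a e w))
        (solve 4 (λ a c i x → a :* c :* i :+ a :* x := a :* (c :* i :+ x)) refl a c (immaculate δ w) (evalExp e w))

expansion-unique : ∀ e e′ → ValidExpansion e → ValidExpansion e′ → evalExp e ≈N evalExp e′ →
                   ∀ γ → coeffOf γ e ≡ coeffOf γ e′
expansion-unique e e′ valid valid′ e≈e′ γ = difference-zero (coeffOf γ e) (coeffOf γ e′) (begin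
    coeffOf γ e ℚ.+ ℚ.- 1ℚ ℚ.* coeffOf γ e′   ≡⟨ cong (coeffOf γ e ℚ.+_) (sym (⟦scale⟧ (ℚ.- 1ℚ) e′ γ)) ⟩
    coeffOf γ e ℚ.+ coeffOf γ (-e′)           ≡⟨ sym (⟦++⟧ e -e′ γ) ⟩
    coeffOf γ (e ++ -e′)                      ≡⟨ independent _ (e ++ -e′) ℕP.≤-refl (AllP.++⁺ valid (AllP.map⁺ valid′)) difference≈0 γ ⟩
    0ℚ                                        ∎)
  where
    open ≡-Reasoning
    -e′ : Expansion
    -e′ = scale (ℚ.- 1ℚ) e′
    difference≈0 : evalExp (e ++ -e′) ≈N 0N
    difference≈0 w = begin
        evalExp (e ++ -e′) w                            ≡⟨ evalExp-++ e -e′ w ⟩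
        evalExp e w ℚ.+ evalExp -e′ w                   ≡⟨ cong₂ ℚ._+_ (e≈e′ w) (evalExp-scale (ℚ.- 1ℚ) e′ w) ⟩
        evalExp e′ w ℚ.+ ℚ.- 1ℚ ℚ.* evalExp e′ w        ≡⟨ solve 1 (λ x → x :+ con (ℚ.- 1ℚ) :* x := con 0ℚ) refl (evalExp e′ w) ⟩
        0ℚ                                              ∎

-- 7. Certified structure constants

immaculate-product : ∀ α β → immaculate α ⊗ immaculate β ≈N ⟦ mulList (immList α) (immList β) ⟧
immaculate-product α β w =
  trans (⊗-cong (immaculate≈ α) (immaculate≈ β) w) (⟦⟧-⊗-⟦⟧ (immList α) (immList β) w)

certified-structConst : ∀ α β γ e → ValidExpansion e →
                        TrieCertificate (mulList (immList α) (immList β)) (expList e) →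
                        IsStructConst α β γ (coeffOf γ e)
certified-structConst α β γ e valid certificate =
  (e , valid , product≈e , refl) ,
  λ e′ valid′ product≈e′ → expansion-unique e′ e valid′ valid (λ w → trans (sym (product≈e′ w)) (product≈e w)) γ
  where
    product≈e : immaculate α ⊗ immaculate β ≈N evalExp e
    product≈e w = trans (immaculate-product α β w)
                 (trans (trie-equal (mulList (immList α) (immList β)) (expList e) certificate w)
                        (sym (evalExp≈ e w)))

-- 8. The two products

table : List (List ℕ × ℕ) → Expansion
table = map (λ p → proj₁ p , (+ proj₂ p) ℚ./ 1)

isComposition? : ∀ α → Dec (IsComposition α)
isComposition? = All.all? (0 ℕ.<?_)

validExpansion? : ∀ e → Dec (ValidExpansion e)
validExpansion? = All.all? (isComposition? ∘ proj₁)

-- 𝔖_{(1,1)} 𝔖_{(3,2,2)}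
expansion₁ : Expansion
expansion₁ = table (
  (1 ∷ 1 ∷ 3 ∷ 2 ∷ 2 ∷ [] , 1) ∷
  (1 ∷ 2 ∷ 2 ∷ 2 ∷ 2 ∷ [] , 1) ∷
  (1 ∷ 2 ∷ 3 ∷ 1 ∷ 2 ∷ [] , 1) ∷
  (1 ∷ 2 ∷ 3 ∷ 2 ∷ 1 ∷ [] , 1) ∷
  (1 ∷ 3 ∷ 1 ∷ 2 ∷ 2 ∷ [] , 1) ∷
  (1 ∷ 3 ∷ 2 ∷ 1 ∷ 2 ∷ [] , 1) ∷
  (1 ∷ 3 ∷ 2 ∷ 2 ∷ 1 ∷ [] , 1) ∷
  (1 ∷ 3 ∷ 3 ∷ 2 ∷ [] , 1) ∷
  (1 ∷ 4 ∷ 2 ∷ 2 ∷ [] , 1) ∷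
  (2 ∷ 1 ∷ 2 ∷ 2 ∷ 2 ∷ [] , 1) ∷
  (2 ∷ 1 ∷ 3 ∷ 1 ∷ 2 ∷ [] , 1) ∷
  (2 ∷ 1 ∷ 3 ∷ 2 ∷ 1 ∷ [] , 1) ∷
  (2 ∷ 2 ∷ 1 ∷ 2 ∷ 2 ∷ [] , 1) ∷
  (2 ∷ 2 ∷ 2 ∷ 1 ∷ 2 ∷ [] , 2) ∷
  (2 ∷ 2 ∷ 2 ∷ 2 ∷ 1 ∷ [] , 2) ∷
  (2 ∷ 2 ∷ 3 ∷ 1 ∷ 1 ∷ [] , 1) ∷
  (2 ∷ 2 ∷ 3 ∷ 2 ∷ [] , 1) ∷
  (2 ∷ 3 ∷ 1 ∷ 1 ∷ 2 ∷ [] , 1) ∷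
  (2 ∷ 3 ∷ 1 ∷ 2 ∷ 1 ∷ [] , 1) ∷
  (2 ∷ 3 ∷ 2 ∷ 1 ∷ 1 ∷ [] , 1) ∷
  (2 ∷ 3 ∷ 2 ∷ 2 ∷ [] , 2) ∷
  (2 ∷ 3 ∷ 3 ∷ 1 ∷ [] , 1) ∷
  (2 ∷ 4 ∷ 1 ∷ 2 ∷ [] , 1) ∷
  (2 ∷ 4 ∷ 2 ∷ 1 ∷ [] , 1) ∷
  (3 ∷ 1 ∷ 1 ∷ 2 ∷ 2 ∷ [] , 1) ∷
  (3 ∷ 1 ∷ 2 ∷ 1 ∷ 2 ∷ [] , 1) ∷
  (3 ∷ 1 ∷ 2 ∷ 2 ∷ 1 ∷ [] , 1) ∷
  (3 ∷ 1 ∷ 3 ∷ 2 ∷ [] , 1) ∷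
  (3 ∷ 2 ∷ 1 ∷ 1 ∷ 2 ∷ [] , 1) ∷
  (3 ∷ 2 ∷ 1 ∷ 2 ∷ 1 ∷ [] , 1) ∷
  (3 ∷ 2 ∷ 2 ∷ 1 ∷ 1 ∷ [] , 1) ∷
  (3 ∷ 2 ∷ 2 ∷ 2 ∷ [] , 2) ∷
  (3 ∷ 2 ∷ 3 ∷ 1 ∷ [] , 1) ∷
  (3 ∷ 3 ∷ 1 ∷ 2 ∷ [] , 2) ∷
  (3 ∷ 3 ∷ 2 ∷ 1 ∷ [] , 2) ∷
  (3 ∷ 3 ∷ 3 ∷ [] , 1) ∷
  (3 ∷ 4 ∷ 2 ∷ [] , 1) ∷
  (4 ∷ 1 ∷ 2 ∷ 2 ∷ [] , 1) ∷
  (4 ∷ 2 ∷ 1 ∷ 2 ∷ [] , 1) ∷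
  (4 ∷ 2 ∷ 2 ∷ 1 ∷ [] , 1) ∷
  (4 ∷ 3 ∷ 2 ∷ [] , 1) ∷
  []
  )

-- 𝔖_{(2,2)} 𝔖_{(6,4,4)}
expansion₂ : Expansion
expansion₂ = table (
  (2 ∷ 2 ∷ 6 ∷ 4 ∷ 4 ∷ [] , 1) ∷
  (2 ∷ 3 ∷ 5 ∷ 4 ∷ 4 ∷ [] , 1) ∷
  (2 ∷ 3 ∷ 6 ∷ 3 ∷ 4 ∷ [] , 1) ∷
  (2 ∷ 3 ∷ 6 ∷ 4 ∷ 3 ∷ [] , 1) ∷
  (2 ∷ 4 ∷ 4 ∷ 4 ∷ 4 ∷ [] , 1) ∷
  (2 ∷ 4 ∷ 5 ∷ 3 ∷ 4 ∷ [] , 1) ∷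
  (2 ∷ 4 ∷ 5 ∷ 4 ∷ 3 ∷ [] , 1) ∷
  (2 ∷ 4 ∷ 6 ∷ 2 ∷ 4 ∷ [] , 1) ∷
  (2 ∷ 4 ∷ 6 ∷ 3 ∷ 3 ∷ [] , 1) ∷
  (2 ∷ 4 ∷ 6 ∷ 4 ∷ 2 ∷ [] , 1) ∷
  (2 ∷ 5 ∷ 3 ∷ 4 ∷ 4 ∷ [] , 1) ∷
  (2 ∷ 5 ∷ 4 ∷ 3 ∷ 4 ∷ [] , 1) ∷
  (2 ∷ 5 ∷ 4 ∷ 4 ∷ 3 ∷ [] , 1) ∷
  (2 ∷ 5 ∷ 5 ∷ 2 ∷ 4 ∷ [] , 1) ∷
  (2 ∷ 5 ∷ 5 ∷ 3 ∷ 3 ∷ [] , 1) ∷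
  (2 ∷ 5 ∷ 5 ∷ 4 ∷ 2 ∷ [] , 1) ∷
  (2 ∷ 5 ∷ 6 ∷ 1 ∷ 4 ∷ [] , 1) ∷
  (2 ∷ 5 ∷ 6 ∷ 2 ∷ 3 ∷ [] , 1) ∷
  (2 ∷ 5 ∷ 6 ∷ 3 ∷ 2 ∷ [] , 1) ∷
  (2 ∷ 5 ∷ 6 ∷ 4 ∷ 1 ∷ [] , 1) ∷
  (2 ∷ 6 ∷ 2 ∷ 4 ∷ 4 ∷ [] , 1) ∷
  (2 ∷ 6 ∷ 3 ∷ 3 ∷ 4 ∷ [] , 1) ∷
  (2 ∷ 6 ∷ 3 ∷ 4 ∷ 3 ∷ [] , 1) ∷
  (2 ∷ 6 ∷ 4 ∷ 2 ∷ 4 ∷ [] , 1) ∷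
  (2 ∷ 6 ∷ 4 ∷ 3 ∷ 3 ∷ [] , 1) ∷
  (2 ∷ 6 ∷ 4 ∷ 4 ∷ 2 ∷ [] , 1) ∷
  (2 ∷ 6 ∷ 5 ∷ 1 ∷ 4 ∷ [] , 1) ∷
  (2 ∷ 6 ∷ 5 ∷ 2 ∷ 3 ∷ [] , 1) ∷
  (2 ∷ 6 ∷ 5 ∷ 3 ∷ 2 ∷ [] , 1) ∷
  (2 ∷ 6 ∷ 5 ∷ 4 ∷ 1 ∷ [] , 1) ∷
  (2 ∷ 6 ∷ 6 ∷ 4 ∷ [] , 1) ∷
  (2 ∷ 7 ∷ 1 ∷ 4 ∷ 4 ∷ [] , 1) ∷
  (2 ∷ 7 ∷ 2 ∷ 3 ∷ 4 ∷ [] , 1) ∷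
  (2 ∷ 7 ∷ 2 ∷ 4 ∷ 3 ∷ [] , 1) ∷
  (2 ∷ 7 ∷ 3 ∷ 2 ∷ 4 ∷ [] , 1) ∷
  (2 ∷ 7 ∷ 3 ∷ 3 ∷ 3 ∷ [] , 1) ∷
  (2 ∷ 7 ∷ 3 ∷ 4 ∷ 2 ∷ [] , 1) ∷
  (2 ∷ 7 ∷ 4 ∷ 1 ∷ 4 ∷ [] , 1) ∷
  (2 ∷ 7 ∷ 4 ∷ 2 ∷ 3 ∷ [] , 1) ∷
  (2 ∷ 7 ∷ 4 ∷ 3 ∷ 2 ∷ [] , 1) ∷
  (2 ∷ 7 ∷ 4 ∷ 4 ∷ 1 ∷ [] , 1) ∷
  (2 ∷ 7 ∷ 5 ∷ 4 ∷ [] , 1) ∷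
  (2 ∷ 8 ∷ 4 ∷ 4 ∷ [] , 1) ∷
  (3 ∷ 2 ∷ 5 ∷ 4 ∷ 4 ∷ [] , 1) ∷
  (3 ∷ 2 ∷ 6 ∷ 3 ∷ 4 ∷ [] , 1) ∷
  (3 ∷ 2 ∷ 6 ∷ 4 ∷ 3 ∷ [] , 1) ∷
  (3 ∷ 3 ∷ 4 ∷ 4 ∷ 4 ∷ [] , 1) ∷
  (3 ∷ 3 ∷ 5 ∷ 3 ∷ 4 ∷ [] , 2) ∷
  (3 ∷ 3 ∷ 5 ∷ 4 ∷ 3 ∷ [] , 2) ∷
  (3 ∷ 3 ∷ 6 ∷ 2 ∷ 4 ∷ [] , 1) ∷
  (3 ∷ 3 ∷ 6 ∷ 3 ∷ 3 ∷ [] , 2) ∷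
  (3 ∷ 3 ∷ 6 ∷ 4 ∷ 2 ∷ [] , 1) ∷
  (3 ∷ 4 ∷ 3 ∷ 4 ∷ 4 ∷ [] , 1) ∷
  (3 ∷ 4 ∷ 4 ∷ 3 ∷ 4 ∷ [] , 2) ∷
  (3 ∷ 4 ∷ 4 ∷ 4 ∷ 3 ∷ [] , 2) ∷
  (3 ∷ 4 ∷ 5 ∷ 2 ∷ 4 ∷ [] , 2) ∷
  (3 ∷ 4 ∷ 5 ∷ 3 ∷ 3 ∷ [] , 3) ∷
  (3 ∷ 4 ∷ 5 ∷ 4 ∷ 2 ∷ [] , 2) ∷
  (3 ∷ 4 ∷ 6 ∷ 1 ∷ 4 ∷ [] , 1) ∷
  (3 ∷ 4 ∷ 6 ∷ 2 ∷ 3 ∷ [] , 2) ∷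
  (3 ∷ 4 ∷ 6 ∷ 3 ∷ 2 ∷ [] , 2) ∷
  (3 ∷ 4 ∷ 6 ∷ 4 ∷ 1 ∷ [] , 1) ∷
  (3 ∷ 5 ∷ 2 ∷ 4 ∷ 4 ∷ [] , 1) ∷
  (3 ∷ 5 ∷ 3 ∷ 3 ∷ 4 ∷ [] , 2) ∷
  (3 ∷ 5 ∷ 3 ∷ 4 ∷ 3 ∷ [] , 2) ∷
  (3 ∷ 5 ∷ 4 ∷ 2 ∷ 4 ∷ [] , 2) ∷
  (3 ∷ 5 ∷ 4 ∷ 3 ∷ 3 ∷ [] , 3) ∷
  (3 ∷ 5 ∷ 4 ∷ 4 ∷ 2 ∷ [] , 2) ∷
  (3 ∷ 5 ∷ 5 ∷ 1 ∷ 4 ∷ [] , 2) ∷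
  (3 ∷ 5 ∷ 5 ∷ 2 ∷ 3 ∷ [] , 3) ∷
  (3 ∷ 5 ∷ 5 ∷ 3 ∷ 2 ∷ [] , 3) ∷
  (3 ∷ 5 ∷ 5 ∷ 4 ∷ 1 ∷ [] , 2) ∷
  (3 ∷ 5 ∷ 6 ∷ 1 ∷ 3 ∷ [] , 1) ∷
  (3 ∷ 5 ∷ 6 ∷ 2 ∷ 2 ∷ [] , 1) ∷
  (3 ∷ 5 ∷ 6 ∷ 3 ∷ 1 ∷ [] , 1) ∷
  (3 ∷ 5 ∷ 6 ∷ 4 ∷ [] , 1) ∷
  (3 ∷ 6 ∷ 1 ∷ 4 ∷ 4 ∷ [] , 1) ∷
  (3 ∷ 6 ∷ 2 ∷ 3 ∷ 4 ∷ [] , 2) ∷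
  (3 ∷ 6 ∷ 2 ∷ 4 ∷ 3 ∷ [] , 2) ∷
  (3 ∷ 6 ∷ 3 ∷ 2 ∷ 4 ∷ [] , 2) ∷
  (3 ∷ 6 ∷ 3 ∷ 3 ∷ 3 ∷ [] , 3) ∷
  (3 ∷ 6 ∷ 3 ∷ 4 ∷ 2 ∷ [] , 2) ∷
  (3 ∷ 6 ∷ 4 ∷ 1 ∷ 4 ∷ [] , 2) ∷
  (3 ∷ 6 ∷ 4 ∷ 2 ∷ 3 ∷ [] , 3) ∷
  (3 ∷ 6 ∷ 4 ∷ 3 ∷ 2 ∷ [] , 3) ∷
  (3 ∷ 6 ∷ 4 ∷ 4 ∷ 1 ∷ [] , 2) ∷
  (3 ∷ 6 ∷ 5 ∷ 1 ∷ 3 ∷ [] , 1) ∷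
  (3 ∷ 6 ∷ 5 ∷ 2 ∷ 2 ∷ [] , 1) ∷
  (3 ∷ 6 ∷ 5 ∷ 3 ∷ 1 ∷ [] , 1) ∷
  (3 ∷ 6 ∷ 5 ∷ 4 ∷ [] , 2) ∷
  (3 ∷ 6 ∷ 6 ∷ 3 ∷ [] , 1) ∷
  (3 ∷ 7 ∷ 1 ∷ 3 ∷ 4 ∷ [] , 1) ∷
  (3 ∷ 7 ∷ 1 ∷ 4 ∷ 3 ∷ [] , 1) ∷
  (3 ∷ 7 ∷ 2 ∷ 2 ∷ 4 ∷ [] , 1) ∷
  (3 ∷ 7 ∷ 2 ∷ 3 ∷ 3 ∷ [] , 2) ∷
  (3 ∷ 7 ∷ 2 ∷ 4 ∷ 2 ∷ [] , 1) ∷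
  (3 ∷ 7 ∷ 3 ∷ 1 ∷ 4 ∷ [] , 1) ∷
  (3 ∷ 7 ∷ 3 ∷ 2 ∷ 3 ∷ [] , 2) ∷
  (3 ∷ 7 ∷ 3 ∷ 3 ∷ 2 ∷ [] , 2) ∷
  (3 ∷ 7 ∷ 3 ∷ 4 ∷ 1 ∷ [] , 1) ∷
  (3 ∷ 7 ∷ 4 ∷ 1 ∷ 3 ∷ [] , 1) ∷
  (3 ∷ 7 ∷ 4 ∷ 2 ∷ 2 ∷ [] , 1) ∷
  (3 ∷ 7 ∷ 4 ∷ 3 ∷ 1 ∷ [] , 1) ∷
  (3 ∷ 7 ∷ 4 ∷ 4 ∷ [] , 2) ∷
  (3 ∷ 7 ∷ 5 ∷ 3 ∷ [] , 1) ∷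
  (3 ∷ 8 ∷ 3 ∷ 4 ∷ [] , 1) ∷
  (3 ∷ 8 ∷ 4 ∷ 3 ∷ [] , 1) ∷
  (4 ∷ 2 ∷ 4 ∷ 4 ∷ 4 ∷ [] , 1) ∷
  (4 ∷ 2 ∷ 5 ∷ 3 ∷ 4 ∷ [] , 1) ∷
  (4 ∷ 2 ∷ 5 ∷ 4 ∷ 3 ∷ [] , 1) ∷
  (4 ∷ 2 ∷ 6 ∷ 2 ∷ 4 ∷ [] , 1) ∷
  (4 ∷ 2 ∷ 6 ∷ 3 ∷ 3 ∷ [] , 1) ∷
  (4 ∷ 2 ∷ 6 ∷ 4 ∷ 2 ∷ [] , 1) ∷
  (4 ∷ 3 ∷ 3 ∷ 4 ∷ 4 ∷ [] , 1) ∷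
  (4 ∷ 3 ∷ 4 ∷ 3 ∷ 4 ∷ [] , 2) ∷
  (4 ∷ 3 ∷ 4 ∷ 4 ∷ 3 ∷ [] , 2) ∷
  (4 ∷ 3 ∷ 5 ∷ 2 ∷ 4 ∷ [] , 2) ∷
  (4 ∷ 3 ∷ 5 ∷ 3 ∷ 3 ∷ [] , 3) ∷
  (4 ∷ 3 ∷ 5 ∷ 4 ∷ 2 ∷ [] , 2) ∷
  (4 ∷ 3 ∷ 6 ∷ 1 ∷ 4 ∷ [] , 1) ∷
  (4 ∷ 3 ∷ 6 ∷ 2 ∷ 3 ∷ [] , 2) ∷
  (4 ∷ 3 ∷ 6 ∷ 3 ∷ 2 ∷ [] , 2) ∷
  (4 ∷ 3 ∷ 6 ∷ 4 ∷ 1 ∷ [] , 1) ∷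
  (4 ∷ 4 ∷ 2 ∷ 4 ∷ 4 ∷ [] , 1) ∷
  (4 ∷ 4 ∷ 3 ∷ 3 ∷ 4 ∷ [] , 2) ∷
  (4 ∷ 4 ∷ 3 ∷ 4 ∷ 3 ∷ [] , 2) ∷
  (4 ∷ 4 ∷ 4 ∷ 2 ∷ 4 ∷ [] , 3) ∷
  (4 ∷ 4 ∷ 4 ∷ 3 ∷ 3 ∷ [] , 4) ∷
  (4 ∷ 4 ∷ 4 ∷ 4 ∷ 2 ∷ [] , 3) ∷
  (4 ∷ 4 ∷ 5 ∷ 1 ∷ 4 ∷ [] , 2) ∷
  (4 ∷ 4 ∷ 5 ∷ 2 ∷ 3 ∷ [] , 4) ∷
  (4 ∷ 4 ∷ 5 ∷ 3 ∷ 2 ∷ [] , 4) ∷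
  (4 ∷ 4 ∷ 5 ∷ 4 ∷ 1 ∷ [] , 2) ∷
  (4 ∷ 4 ∷ 6 ∷ 1 ∷ 3 ∷ [] , 1) ∷
  (4 ∷ 4 ∷ 6 ∷ 2 ∷ 2 ∷ [] , 2) ∷
  (4 ∷ 4 ∷ 6 ∷ 3 ∷ 1 ∷ [] , 1) ∷
  (4 ∷ 4 ∷ 6 ∷ 4 ∷ [] , 1) ∷
  (4 ∷ 5 ∷ 1 ∷ 4 ∷ 4 ∷ [] , 1) ∷
  (4 ∷ 5 ∷ 2 ∷ 3 ∷ 4 ∷ [] , 2) ∷
  (4 ∷ 5 ∷ 2 ∷ 4 ∷ 3 ∷ [] , 2) ∷
  (4 ∷ 5 ∷ 3 ∷ 2 ∷ 4 ∷ [] , 3) ∷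
  (4 ∷ 5 ∷ 3 ∷ 3 ∷ 3 ∷ [] , 4) ∷
  (4 ∷ 5 ∷ 3 ∷ 4 ∷ 2 ∷ [] , 3) ∷
  (4 ∷ 5 ∷ 4 ∷ 1 ∷ 4 ∷ [] , 3) ∷
  (4 ∷ 5 ∷ 4 ∷ 2 ∷ 3 ∷ [] , 5) ∷
  (4 ∷ 5 ∷ 4 ∷ 3 ∷ 2 ∷ [] , 5) ∷
  (4 ∷ 5 ∷ 4 ∷ 4 ∷ 1 ∷ [] , 3) ∷
  (4 ∷ 5 ∷ 5 ∷ 1 ∷ 3 ∷ [] , 2) ∷
  (4 ∷ 5 ∷ 5 ∷ 2 ∷ 2 ∷ [] , 3) ∷
  (4 ∷ 5 ∷ 5 ∷ 3 ∷ 1 ∷ [] , 2) ∷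
  (4 ∷ 5 ∷ 5 ∷ 4 ∷ [] , 2) ∷
  (4 ∷ 5 ∷ 6 ∷ 1 ∷ 2 ∷ [] , 1) ∷
  (4 ∷ 5 ∷ 6 ∷ 2 ∷ 1 ∷ [] , 1) ∷
  (4 ∷ 5 ∷ 6 ∷ 3 ∷ [] , 1) ∷
  (4 ∷ 6 ∷ 1 ∷ 3 ∷ 4 ∷ [] , 1) ∷
  (4 ∷ 6 ∷ 1 ∷ 4 ∷ 3 ∷ [] , 1) ∷
  (4 ∷ 6 ∷ 2 ∷ 2 ∷ 4 ∷ [] , 2) ∷
  (4 ∷ 6 ∷ 2 ∷ 3 ∷ 3 ∷ [] , 3) ∷
  (4 ∷ 6 ∷ 2 ∷ 4 ∷ 2 ∷ [] , 2) ∷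
  (4 ∷ 6 ∷ 3 ∷ 1 ∷ 4 ∷ [] , 2) ∷
  (4 ∷ 6 ∷ 3 ∷ 2 ∷ 3 ∷ [] , 4) ∷
  (4 ∷ 6 ∷ 3 ∷ 3 ∷ 2 ∷ [] , 4) ∷
  (4 ∷ 6 ∷ 3 ∷ 4 ∷ 1 ∷ [] , 2) ∷
  (4 ∷ 6 ∷ 4 ∷ 1 ∷ 3 ∷ [] , 2) ∷
  (4 ∷ 6 ∷ 4 ∷ 2 ∷ 2 ∷ [] , 3) ∷
  (4 ∷ 6 ∷ 4 ∷ 3 ∷ 1 ∷ [] , 2) ∷
  (4 ∷ 6 ∷ 4 ∷ 4 ∷ [] , 3) ∷
  (4 ∷ 6 ∷ 5 ∷ 1 ∷ 2 ∷ [] , 1) ∷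
  (4 ∷ 6 ∷ 5 ∷ 2 ∷ 1 ∷ [] , 1) ∷
  (4 ∷ 6 ∷ 5 ∷ 3 ∷ [] , 2) ∷
  (4 ∷ 6 ∷ 6 ∷ 2 ∷ [] , 1) ∷
  (4 ∷ 7 ∷ 1 ∷ 2 ∷ 4 ∷ [] , 1) ∷
  (4 ∷ 7 ∷ 1 ∷ 3 ∷ 3 ∷ [] , 1) ∷
  (4 ∷ 7 ∷ 1 ∷ 4 ∷ 2 ∷ [] , 1) ∷
  (4 ∷ 7 ∷ 2 ∷ 1 ∷ 4 ∷ [] , 1) ∷
  (4 ∷ 7 ∷ 2 ∷ 2 ∷ 3 ∷ [] , 2) ∷
  (4 ∷ 7 ∷ 2 ∷ 3 ∷ 2 ∷ [] , 2) ∷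
  (4 ∷ 7 ∷ 2 ∷ 4 ∷ 1 ∷ [] , 1) ∷
  (4 ∷ 7 ∷ 3 ∷ 1 ∷ 3 ∷ [] , 1) ∷
  (4 ∷ 7 ∷ 3 ∷ 2 ∷ 2 ∷ [] , 2) ∷
  (4 ∷ 7 ∷ 3 ∷ 3 ∷ 1 ∷ [] , 1) ∷
  (4 ∷ 7 ∷ 3 ∷ 4 ∷ [] , 2) ∷
  (4 ∷ 7 ∷ 4 ∷ 1 ∷ 2 ∷ [] , 1) ∷
  (4 ∷ 7 ∷ 4 ∷ 2 ∷ 1 ∷ [] , 1) ∷
  (4 ∷ 7 ∷ 4 ∷ 3 ∷ [] , 2) ∷
  (4 ∷ 7 ∷ 5 ∷ 2 ∷ [] , 1) ∷
  (4 ∷ 8 ∷ 2 ∷ 4 ∷ [] , 1) ∷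
  (4 ∷ 8 ∷ 3 ∷ 3 ∷ [] , 1) ∷
  (4 ∷ 8 ∷ 4 ∷ 2 ∷ [] , 1) ∷
  (5 ∷ 2 ∷ 3 ∷ 4 ∷ 4 ∷ [] , 1) ∷
  (5 ∷ 2 ∷ 4 ∷ 3 ∷ 4 ∷ [] , 1) ∷
  (5 ∷ 2 ∷ 4 ∷ 4 ∷ 3 ∷ [] , 1) ∷
  (5 ∷ 2 ∷ 5 ∷ 2 ∷ 4 ∷ [] , 1) ∷
  (5 ∷ 2 ∷ 5 ∷ 3 ∷ 3 ∷ [] , 1) ∷
  (5 ∷ 2 ∷ 5 ∷ 4 ∷ 2 ∷ [] , 1) ∷
  (5 ∷ 2 ∷ 6 ∷ 1 ∷ 4 ∷ [] , 1) ∷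
  (5 ∷ 2 ∷ 6 ∷ 2 ∷ 3 ∷ [] , 1) ∷
  (5 ∷ 2 ∷ 6 ∷ 3 ∷ 2 ∷ [] , 1) ∷
  (5 ∷ 2 ∷ 6 ∷ 4 ∷ 1 ∷ [] , 1) ∷
  (5 ∷ 3 ∷ 2 ∷ 4 ∷ 4 ∷ [] , 1) ∷
  (5 ∷ 3 ∷ 3 ∷ 3 ∷ 4 ∷ [] , 2) ∷
  (5 ∷ 3 ∷ 3 ∷ 4 ∷ 3 ∷ [] , 2) ∷
  (5 ∷ 3 ∷ 4 ∷ 2 ∷ 4 ∷ [] , 2) ∷
  (5 ∷ 3 ∷ 4 ∷ 3 ∷ 3 ∷ [] , 3) ∷
  (5 ∷ 3 ∷ 4 ∷ 4 ∷ 2 ∷ [] , 2) ∷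
  (5 ∷ 3 ∷ 5 ∷ 1 ∷ 4 ∷ [] , 2) ∷
  (5 ∷ 3 ∷ 5 ∷ 2 ∷ 3 ∷ [] , 3) ∷
  (5 ∷ 3 ∷ 5 ∷ 3 ∷ 2 ∷ [] , 3) ∷
  (5 ∷ 3 ∷ 5 ∷ 4 ∷ 1 ∷ [] , 2) ∷
  (5 ∷ 3 ∷ 6 ∷ 1 ∷ 3 ∷ [] , 1) ∷
  (5 ∷ 3 ∷ 6 ∷ 2 ∷ 2 ∷ [] , 1) ∷
  (5 ∷ 3 ∷ 6 ∷ 3 ∷ 1 ∷ [] , 1) ∷
  (5 ∷ 3 ∷ 6 ∷ 4 ∷ [] , 1) ∷
  (5 ∷ 4 ∷ 1 ∷ 4 ∷ 4 ∷ [] , 1) ∷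
  (5 ∷ 4 ∷ 2 ∷ 3 ∷ 4 ∷ [] , 2) ∷
  (5 ∷ 4 ∷ 2 ∷ 4 ∷ 3 ∷ [] , 2) ∷
  (5 ∷ 4 ∷ 3 ∷ 2 ∷ 4 ∷ [] , 3) ∷
  (5 ∷ 4 ∷ 3 ∷ 3 ∷ 3 ∷ [] , 4) ∷
  (5 ∷ 4 ∷ 3 ∷ 4 ∷ 2 ∷ [] , 3) ∷
  (5 ∷ 4 ∷ 4 ∷ 1 ∷ 4 ∷ [] , 3) ∷
  (5 ∷ 4 ∷ 4 ∷ 2 ∷ 3 ∷ [] , 5) ∷
  (5 ∷ 4 ∷ 4 ∷ 3 ∷ 2 ∷ [] , 5) ∷
  (5 ∷ 4 ∷ 4 ∷ 4 ∷ 1 ∷ [] , 3) ∷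
  (5 ∷ 4 ∷ 5 ∷ 1 ∷ 3 ∷ [] , 2) ∷
  (5 ∷ 4 ∷ 5 ∷ 2 ∷ 2 ∷ [] , 3) ∷
  (5 ∷ 4 ∷ 5 ∷ 3 ∷ 1 ∷ [] , 2) ∷
  (5 ∷ 4 ∷ 5 ∷ 4 ∷ [] , 2) ∷
  (5 ∷ 4 ∷ 6 ∷ 1 ∷ 2 ∷ [] , 1) ∷
  (5 ∷ 4 ∷ 6 ∷ 2 ∷ 1 ∷ [] , 1) ∷
  (5 ∷ 4 ∷ 6 ∷ 3 ∷ [] , 1) ∷
  (5 ∷ 5 ∷ 1 ∷ 3 ∷ 4 ∷ [] , 1) ∷
  (5 ∷ 5 ∷ 1 ∷ 4 ∷ 3 ∷ [] , 1) ∷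
  (5 ∷ 5 ∷ 2 ∷ 2 ∷ 4 ∷ [] , 2) ∷
  (5 ∷ 5 ∷ 2 ∷ 3 ∷ 3 ∷ [] , 3) ∷
  (5 ∷ 5 ∷ 2 ∷ 4 ∷ 2 ∷ [] , 2) ∷
  (5 ∷ 5 ∷ 3 ∷ 1 ∷ 4 ∷ [] , 3) ∷
  (5 ∷ 5 ∷ 3 ∷ 2 ∷ 3 ∷ [] , 5) ∷
  (5 ∷ 5 ∷ 3 ∷ 3 ∷ 2 ∷ [] , 5) ∷
  (5 ∷ 5 ∷ 3 ∷ 4 ∷ 1 ∷ [] , 3) ∷
  (5 ∷ 5 ∷ 4 ∷ 1 ∷ 3 ∷ [] , 3) ∷
  (5 ∷ 5 ∷ 4 ∷ 2 ∷ 2 ∷ [] , 4) ∷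
  (5 ∷ 5 ∷ 4 ∷ 3 ∷ 1 ∷ [] , 3) ∷
  (5 ∷ 5 ∷ 4 ∷ 4 ∷ [] , 3) ∷
  (5 ∷ 5 ∷ 5 ∷ 1 ∷ 2 ∷ [] , 2) ∷
  (5 ∷ 5 ∷ 5 ∷ 2 ∷ 1 ∷ [] , 2) ∷
  (5 ∷ 5 ∷ 5 ∷ 3 ∷ [] , 2) ∷
  (5 ∷ 5 ∷ 6 ∷ 1 ∷ 1 ∷ [] , 1) ∷
  (5 ∷ 5 ∷ 6 ∷ 2 ∷ [] , 1) ∷
  (5 ∷ 6 ∷ 1 ∷ 2 ∷ 4 ∷ [] , 1) ∷
  (5 ∷ 6 ∷ 1 ∷ 3 ∷ 3 ∷ [] , 1) ∷
  (5 ∷ 6 ∷ 1 ∷ 4 ∷ 2 ∷ [] , 1) ∷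
  (5 ∷ 6 ∷ 2 ∷ 1 ∷ 4 ∷ [] , 2) ∷
  (5 ∷ 6 ∷ 2 ∷ 2 ∷ 3 ∷ [] , 3) ∷
  (5 ∷ 6 ∷ 2 ∷ 3 ∷ 2 ∷ [] , 3) ∷
  (5 ∷ 6 ∷ 2 ∷ 4 ∷ 1 ∷ [] , 2) ∷
  (5 ∷ 6 ∷ 3 ∷ 1 ∷ 3 ∷ [] , 2) ∷
  (5 ∷ 6 ∷ 3 ∷ 2 ∷ 2 ∷ [] , 3) ∷
  (5 ∷ 6 ∷ 3 ∷ 3 ∷ 1 ∷ [] , 2) ∷
  (5 ∷ 6 ∷ 3 ∷ 4 ∷ [] , 3) ∷
  (5 ∷ 6 ∷ 4 ∷ 1 ∷ 2 ∷ [] , 2) ∷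
  (5 ∷ 6 ∷ 4 ∷ 2 ∷ 1 ∷ [] , 2) ∷
  (5 ∷ 6 ∷ 4 ∷ 3 ∷ [] , 3) ∷
  (5 ∷ 6 ∷ 5 ∷ 1 ∷ 1 ∷ [] , 1) ∷
  (5 ∷ 6 ∷ 5 ∷ 2 ∷ [] , 2) ∷
  (5 ∷ 6 ∷ 6 ∷ 1 ∷ [] , 1) ∷
  (5 ∷ 7 ∷ 1 ∷ 1 ∷ 4 ∷ [] , 1) ∷
  (5 ∷ 7 ∷ 1 ∷ 2 ∷ 3 ∷ [] , 1) ∷
  (5 ∷ 7 ∷ 1 ∷ 3 ∷ 2 ∷ [] , 1) ∷
  (5 ∷ 7 ∷ 1 ∷ 4 ∷ 1 ∷ [] , 1) ∷
  (5 ∷ 7 ∷ 2 ∷ 1 ∷ 3 ∷ [] , 1) ∷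
  (5 ∷ 7 ∷ 2 ∷ 2 ∷ 2 ∷ [] , 1) ∷
  (5 ∷ 7 ∷ 2 ∷ 3 ∷ 1 ∷ [] , 1) ∷
  (5 ∷ 7 ∷ 2 ∷ 4 ∷ [] , 2) ∷
  (5 ∷ 7 ∷ 3 ∷ 1 ∷ 2 ∷ [] , 1) ∷
  (5 ∷ 7 ∷ 3 ∷ 2 ∷ 1 ∷ [] , 1) ∷
  (5 ∷ 7 ∷ 3 ∷ 3 ∷ [] , 2) ∷
  (5 ∷ 7 ∷ 4 ∷ 1 ∷ 1 ∷ [] , 1) ∷
  (5 ∷ 7 ∷ 4 ∷ 2 ∷ [] , 2) ∷
  (5 ∷ 7 ∷ 5 ∷ 1 ∷ [] , 1) ∷
  (5 ∷ 8 ∷ 1 ∷ 4 ∷ [] , 1) ∷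
  (5 ∷ 8 ∷ 2 ∷ 3 ∷ [] , 1) ∷
  (5 ∷ 8 ∷ 3 ∷ 2 ∷ [] , 1) ∷
  (5 ∷ 8 ∷ 4 ∷ 1 ∷ [] , 1) ∷
  (6 ∷ 2 ∷ 2 ∷ 4 ∷ 4 ∷ [] , 1) ∷
  (6 ∷ 2 ∷ 3 ∷ 3 ∷ 4 ∷ [] , 1) ∷
  (6 ∷ 2 ∷ 3 ∷ 4 ∷ 3 ∷ [] , 1) ∷
  (6 ∷ 2 ∷ 4 ∷ 2 ∷ 4 ∷ [] , 1) ∷
  (6 ∷ 2 ∷ 4 ∷ 3 ∷ 3 ∷ [] , 1) ∷
  (6 ∷ 2 ∷ 4 ∷ 4 ∷ 2 ∷ [] , 1) ∷
  (6 ∷ 2 ∷ 5 ∷ 1 ∷ 4 ∷ [] , 1) ∷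
  (6 ∷ 2 ∷ 5 ∷ 2 ∷ 3 ∷ [] , 1) ∷
  (6 ∷ 2 ∷ 5 ∷ 3 ∷ 2 ∷ [] , 1) ∷
  (6 ∷ 2 ∷ 5 ∷ 4 ∷ 1 ∷ [] , 1) ∷
  (6 ∷ 2 ∷ 6 ∷ 4 ∷ [] , 1) ∷
  (6 ∷ 3 ∷ 1 ∷ 4 ∷ 4 ∷ [] , 1) ∷
  (6 ∷ 3 ∷ 2 ∷ 3 ∷ 4 ∷ [] , 2) ∷
  (6 ∷ 3 ∷ 2 ∷ 4 ∷ 3 ∷ [] , 2) ∷
  (6 ∷ 3 ∷ 3 ∷ 2 ∷ 4 ∷ [] , 2) ∷
  (6 ∷ 3 ∷ 3 ∷ 3 ∷ 3 ∷ [] , 3) ∷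
  (6 ∷ 3 ∷ 3 ∷ 4 ∷ 2 ∷ [] , 2) ∷
  (6 ∷ 3 ∷ 4 ∷ 1 ∷ 4 ∷ [] , 2) ∷
  (6 ∷ 3 ∷ 4 ∷ 2 ∷ 3 ∷ [] , 3) ∷
  (6 ∷ 3 ∷ 4 ∷ 3 ∷ 2 ∷ [] , 3) ∷
  (6 ∷ 3 ∷ 4 ∷ 4 ∷ 1 ∷ [] , 2) ∷
  (6 ∷ 3 ∷ 5 ∷ 1 ∷ 3 ∷ [] , 1) ∷
  (6 ∷ 3 ∷ 5 ∷ 2 ∷ 2 ∷ [] , 1) ∷
  (6 ∷ 3 ∷ 5 ∷ 3 ∷ 1 ∷ [] , 1) ∷
  (6 ∷ 3 ∷ 5 ∷ 4 ∷ [] , 2) ∷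
  (6 ∷ 3 ∷ 6 ∷ 3 ∷ [] , 1) ∷
  (6 ∷ 4 ∷ 1 ∷ 3 ∷ 4 ∷ [] , 1) ∷
  (6 ∷ 4 ∷ 1 ∷ 4 ∷ 3 ∷ [] , 1) ∷
  (6 ∷ 4 ∷ 2 ∷ 2 ∷ 4 ∷ [] , 2) ∷
  (6 ∷ 4 ∷ 2 ∷ 3 ∷ 3 ∷ [] , 3) ∷
  (6 ∷ 4 ∷ 2 ∷ 4 ∷ 2 ∷ [] , 2) ∷
  (6 ∷ 4 ∷ 3 ∷ 1 ∷ 4 ∷ [] , 2) ∷
  (6 ∷ 4 ∷ 3 ∷ 2 ∷ 3 ∷ [] , 4) ∷
  (6 ∷ 4 ∷ 3 ∷ 3 ∷ 2 ∷ [] , 4) ∷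
  (6 ∷ 4 ∷ 3 ∷ 4 ∷ 1 ∷ [] , 2) ∷
  (6 ∷ 4 ∷ 4 ∷ 1 ∷ 3 ∷ [] , 2) ∷
  (6 ∷ 4 ∷ 4 ∷ 2 ∷ 2 ∷ [] , 3) ∷
  (6 ∷ 4 ∷ 4 ∷ 3 ∷ 1 ∷ [] , 2) ∷
  (6 ∷ 4 ∷ 4 ∷ 4 ∷ [] , 3) ∷
  (6 ∷ 4 ∷ 5 ∷ 1 ∷ 2 ∷ [] , 1) ∷
  (6 ∷ 4 ∷ 5 ∷ 2 ∷ 1 ∷ [] , 1) ∷
  (6 ∷ 4 ∷ 5 ∷ 3 ∷ [] , 2) ∷
  (6 ∷ 4 ∷ 6 ∷ 2 ∷ [] , 1) ∷
  (6 ∷ 5 ∷ 1 ∷ 2 ∷ 4 ∷ [] , 1) ∷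
  (6 ∷ 5 ∷ 1 ∷ 3 ∷ 3 ∷ [] , 1) ∷
  (6 ∷ 5 ∷ 1 ∷ 4 ∷ 2 ∷ [] , 1) ∷
  (6 ∷ 5 ∷ 2 ∷ 1 ∷ 4 ∷ [] , 2) ∷
  (6 ∷ 5 ∷ 2 ∷ 2 ∷ 3 ∷ [] , 3) ∷
  (6 ∷ 5 ∷ 2 ∷ 3 ∷ 2 ∷ [] , 3) ∷
  (6 ∷ 5 ∷ 2 ∷ 4 ∷ 1 ∷ [] , 2) ∷
  (6 ∷ 5 ∷ 3 ∷ 1 ∷ 3 ∷ [] , 2) ∷
  (6 ∷ 5 ∷ 3 ∷ 2 ∷ 2 ∷ [] , 3) ∷
  (6 ∷ 5 ∷ 3 ∷ 3 ∷ 1 ∷ [] , 2) ∷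
  (6 ∷ 5 ∷ 3 ∷ 4 ∷ [] , 3) ∷
  (6 ∷ 5 ∷ 4 ∷ 1 ∷ 2 ∷ [] , 2) ∷
  (6 ∷ 5 ∷ 4 ∷ 2 ∷ 1 ∷ [] , 2) ∷
  (6 ∷ 5 ∷ 4 ∷ 3 ∷ [] , 3) ∷
  (6 ∷ 5 ∷ 5 ∷ 1 ∷ 1 ∷ [] , 1) ∷
  (6 ∷ 5 ∷ 5 ∷ 2 ∷ [] , 2) ∷
  (6 ∷ 5 ∷ 6 ∷ 1 ∷ [] , 1) ∷
  (6 ∷ 6 ∷ 1 ∷ 1 ∷ 4 ∷ [] , 1) ∷
  (6 ∷ 6 ∷ 1 ∷ 2 ∷ 3 ∷ [] , 1) ∷
  (6 ∷ 6 ∷ 1 ∷ 3 ∷ 2 ∷ [] , 1) ∷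
  (6 ∷ 6 ∷ 1 ∷ 4 ∷ 1 ∷ [] , 1) ∷
  (6 ∷ 6 ∷ 2 ∷ 1 ∷ 3 ∷ [] , 1) ∷
  (6 ∷ 6 ∷ 2 ∷ 2 ∷ 2 ∷ [] , 1) ∷
  (6 ∷ 6 ∷ 2 ∷ 3 ∷ 1 ∷ [] , 1) ∷
  (6 ∷ 6 ∷ 2 ∷ 4 ∷ [] , 3) ∷
  (6 ∷ 6 ∷ 3 ∷ 1 ∷ 2 ∷ [] , 1) ∷
  (6 ∷ 6 ∷ 3 ∷ 2 ∷ 1 ∷ [] , 1) ∷
  (6 ∷ 6 ∷ 3 ∷ 3 ∷ [] , 3) ∷
  (6 ∷ 6 ∷ 4 ∷ 1 ∷ 1 ∷ [] , 1) ∷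
  (6 ∷ 6 ∷ 4 ∷ 2 ∷ [] , 3) ∷
  (6 ∷ 6 ∷ 5 ∷ 1 ∷ [] , 2) ∷
  (6 ∷ 6 ∷ 6 ∷ [] , 1) ∷
  (6 ∷ 7 ∷ 1 ∷ 4 ∷ [] , 2) ∷
  (6 ∷ 7 ∷ 2 ∷ 3 ∷ [] , 2) ∷
  (6 ∷ 7 ∷ 3 ∷ 2 ∷ [] , 2) ∷
  (6 ∷ 7 ∷ 4 ∷ 1 ∷ [] , 2) ∷
  (6 ∷ 7 ∷ 5 ∷ [] , 1) ∷
  (6 ∷ 8 ∷ 4 ∷ [] , 1) ∷
  (7 ∷ 2 ∷ 1 ∷ 4 ∷ 4 ∷ [] , 1) ∷
  (7 ∷ 2 ∷ 2 ∷ 3 ∷ 4 ∷ [] , 1) ∷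
  (7 ∷ 2 ∷ 2 ∷ 4 ∷ 3 ∷ [] , 1) ∷
  (7 ∷ 2 ∷ 3 ∷ 2 ∷ 4 ∷ [] , 1) ∷
  (7 ∷ 2 ∷ 3 ∷ 3 ∷ 3 ∷ [] , 1) ∷
  (7 ∷ 2 ∷ 3 ∷ 4 ∷ 2 ∷ [] , 1) ∷
  (7 ∷ 2 ∷ 4 ∷ 1 ∷ 4 ∷ [] , 1) ∷
  (7 ∷ 2 ∷ 4 ∷ 2 ∷ 3 ∷ [] , 1) ∷
  (7 ∷ 2 ∷ 4 ∷ 3 ∷ 2 ∷ [] , 1) ∷
  (7 ∷ 2 ∷ 4 ∷ 4 ∷ 1 ∷ [] , 1) ∷
  (7 ∷ 2 ∷ 5 ∷ 4 ∷ [] , 1) ∷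
  (7 ∷ 3 ∷ 1 ∷ 3 ∷ 4 ∷ [] , 1) ∷
  (7 ∷ 3 ∷ 1 ∷ 4 ∷ 3 ∷ [] , 1) ∷
  (7 ∷ 3 ∷ 2 ∷ 2 ∷ 4 ∷ [] , 1) ∷
  (7 ∷ 3 ∷ 2 ∷ 3 ∷ 3 ∷ [] , 2) ∷
  (7 ∷ 3 ∷ 2 ∷ 4 ∷ 2 ∷ [] , 1) ∷
  (7 ∷ 3 ∷ 3 ∷ 1 ∷ 4 ∷ [] , 1) ∷
  (7 ∷ 3 ∷ 3 ∷ 2 ∷ 3 ∷ [] , 2) ∷
  (7 ∷ 3 ∷ 3 ∷ 3 ∷ 2 ∷ [] , 2) ∷
  (7 ∷ 3 ∷ 3 ∷ 4 ∷ 1 ∷ [] , 1) ∷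
  (7 ∷ 3 ∷ 4 ∷ 1 ∷ 3 ∷ [] , 1) ∷
  (7 ∷ 3 ∷ 4 ∷ 2 ∷ 2 ∷ [] , 1) ∷
  (7 ∷ 3 ∷ 4 ∷ 3 ∷ 1 ∷ [] , 1) ∷
  (7 ∷ 3 ∷ 4 ∷ 4 ∷ [] , 2) ∷
  (7 ∷ 3 ∷ 5 ∷ 3 ∷ [] , 1) ∷
  (7 ∷ 4 ∷ 1 ∷ 2 ∷ 4 ∷ [] , 1) ∷
  (7 ∷ 4 ∷ 1 ∷ 3 ∷ 3 ∷ [] , 1) ∷
  (7 ∷ 4 ∷ 1 ∷ 4 ∷ 2 ∷ [] , 1) ∷
  (7 ∷ 4 ∷ 2 ∷ 1 ∷ 4 ∷ [] , 1) ∷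
  (7 ∷ 4 ∷ 2 ∷ 2 ∷ 3 ∷ [] , 2) ∷
  (7 ∷ 4 ∷ 2 ∷ 3 ∷ 2 ∷ [] , 2) ∷
  (7 ∷ 4 ∷ 2 ∷ 4 ∷ 1 ∷ [] , 1) ∷
  (7 ∷ 4 ∷ 3 ∷ 1 ∷ 3 ∷ [] , 1) ∷
  (7 ∷ 4 ∷ 3 ∷ 2 ∷ 2 ∷ [] , 2) ∷
  (7 ∷ 4 ∷ 3 ∷ 3 ∷ 1 ∷ [] , 1) ∷
  (7 ∷ 4 ∷ 3 ∷ 4 ∷ [] , 2) ∷
  (7 ∷ 4 ∷ 4 ∷ 1 ∷ 2 ∷ [] , 1) ∷
  (7 ∷ 4 ∷ 4 ∷ 2 ∷ 1 ∷ [] , 1) ∷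
  (7 ∷ 4 ∷ 4 ∷ 3 ∷ [] , 2) ∷
  (7 ∷ 4 ∷ 5 ∷ 2 ∷ [] , 1) ∷
  (7 ∷ 5 ∷ 1 ∷ 1 ∷ 4 ∷ [] , 1) ∷
  (7 ∷ 5 ∷ 1 ∷ 2 ∷ 3 ∷ [] , 1) ∷
  (7 ∷ 5 ∷ 1 ∷ 3 ∷ 2 ∷ [] , 1) ∷
  (7 ∷ 5 ∷ 1 ∷ 4 ∷ 1 ∷ [] , 1) ∷
  (7 ∷ 5 ∷ 2 ∷ 1 ∷ 3 ∷ [] , 1) ∷
  (7 ∷ 5 ∷ 2 ∷ 2 ∷ 2 ∷ [] , 1) ∷
  (7 ∷ 5 ∷ 2 ∷ 3 ∷ 1 ∷ [] , 1) ∷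
  (7 ∷ 5 ∷ 2 ∷ 4 ∷ [] , 2) ∷
  (7 ∷ 5 ∷ 3 ∷ 1 ∷ 2 ∷ [] , 1) ∷
  (7 ∷ 5 ∷ 3 ∷ 2 ∷ 1 ∷ [] , 1) ∷
  (7 ∷ 5 ∷ 3 ∷ 3 ∷ [] , 2) ∷
  (7 ∷ 5 ∷ 4 ∷ 1 ∷ 1 ∷ [] , 1) ∷
  (7 ∷ 5 ∷ 4 ∷ 2 ∷ [] , 2) ∷
  (7 ∷ 5 ∷ 5 ∷ 1 ∷ [] , 1) ∷
  (7 ∷ 6 ∷ 1 ∷ 4 ∷ [] , 2) ∷
  (7 ∷ 6 ∷ 2 ∷ 3 ∷ [] , 2) ∷
  (7 ∷ 6 ∷ 3 ∷ 2 ∷ [] , 2) ∷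
  (7 ∷ 6 ∷ 4 ∷ 1 ∷ [] , 2) ∷
  (7 ∷ 6 ∷ 5 ∷ [] , 1) ∷
  (7 ∷ 7 ∷ 4 ∷ [] , 1) ∷
  (8 ∷ 2 ∷ 4 ∷ 4 ∷ [] , 1) ∷
  (8 ∷ 3 ∷ 3 ∷ 4 ∷ [] , 1) ∷
  (8 ∷ 3 ∷ 4 ∷ 3 ∷ [] , 1) ∷
  (8 ∷ 4 ∷ 2 ∷ 4 ∷ [] , 1) ∷
  (8 ∷ 4 ∷ 3 ∷ 3 ∷ [] , 1) ∷
  (8 ∷ 4 ∷ 4 ∷ 2 ∷ [] , 1) ∷
  (8 ∷ 5 ∷ 1 ∷ 4 ∷ [] , 1) ∷
  (8 ∷ 5 ∷ 2 ∷ 3 ∷ [] , 1) ∷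
  (8 ∷ 5 ∷ 3 ∷ 2 ∷ [] , 1) ∷
  (8 ∷ 5 ∷ 4 ∷ 1 ∷ [] , 1) ∷
  (8 ∷ 6 ∷ 4 ∷ [] , 1) ∷
  []
  )

-- (3,3,1,1,1) does not occur in the first expansion
structConst₁ : IsStructConst (1 ∷ 1 ∷ []) (3 ∷ 2 ∷ 2 ∷ []) (3 ∷ 3 ∷ 1 ∷ 1 ∷ 1 ∷ []) 0ℚ
structConst₁ = certified-structConst (1 ∷ 1 ∷ []) (3 ∷ 2 ∷ 2 ∷ []) (3 ∷ 3 ∷ 1 ∷ 1 ∷ 1 ∷ [])
  expansion₁ (toWitness {a? = validExpansion? expansion₁} tt) refl

-- (6,6,2,2,2) occurs once in the second expansion
structConst₂ : IsStructConst (2 ∷ 2 ∷ []) (6 ∷ 4 ∷ 4 ∷ []) (6 ∷ 6 ∷ 2 ∷ 2 ∷ 2 ∷ []) 1ℚ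
structConst₂ = certified-structConst (2 ∷ 2 ∷ []) (6 ∷ 4 ∷ 4 ∷ []) (6 ∷ 6 ∷ 2 ∷ 2 ∷ 2 ∷ [])
  expansion₂ (toWitness {a? = validExpansion? expansion₂} tt) refl

ScalingPreservesNonvanishing : Set
ScalingPreservesNonvanishing =
  ∀ (α β γ : List ℕ) (N : ℕ) (c d : ℚ) →
  IsComposition α → IsComposition β → IsComposition γ → 0 < N →
  IsStructConst α β γ c → IsStructConst (N ·c α) (N ·c β) (N ·c γ) d →
  (c ≢ 0ℚ ⇔ d ≢ 0ℚ)

scaling-fails : ¬ ScalingPreservesNonvanishing
scaling-fails preserves =
  Equivalence.from (preserves α β γ 2 0ℚ 1ℚ (composition α) (composition β) (composition γ) (s≤s z≤n)
                              structConst₁ structConst₂)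
                   (λ ()) refl
  where
    α β γ : List ℕ
    α = 1 ∷ 1 ∷ []
    β = 3 ∷ 2 ∷ 2 ∷ []
    γ = 3 ∷ 3 ∷ 1 ∷ 1 ∷ 1 ∷ []
    composition : ∀ δ {valid : True (isComposition? δ)} → IsComposition δ
    composition δ {valid} = toWitness valid

mainTheorem2 : IsStructConst (1 ∷ 1 ∷ []) (3 ∷ 2 ∷ 2 ∷ []) (3 ∷ 3 ∷ 1 ∷ 1 ∷ 1 ∷ []) 0ℚ
    × IsStructConst (2 ∷ 2 ∷ []) (6 ∷ 4 ∷ 4 ∷ []) (6 ∷ 6 ∷ 2 ∷ 2 ∷ 2 ∷ []) 1ℚ
    × ¬ (∀ (α β γ : List ℕ) (N : ℕ) (c d : ℚ) →
           IsComposition α → IsComposition β → IsComposition γ → 0 < N →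
           IsStructConst α β γ c →
           IsStructConst (N ·c α) (N ·c β) (N ·c γ) d →
           (c ≢ 0ℚ ⇔ d ≢ 0ℚ))
mainTheorem2 = structConst₁ , structConst₂ , scaling-fails
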